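{- Let $G$ and $H$ be finite simple graphs without vertices of degree 0. Then: (i) $\gamma_{tR}(G\times H)\notin\{1,2,3,5\}$. (ii) $\gamma_{tR}(G\times H)=4$ if and only if $G$ and $H$ are both isomorphic to $K_2$. (iii) $\gamma_{tR}(G\times H)=6$ if and only if at least one of the following holds: ($G$ and $H$ each have at least two universal vertices and at least one of them has order at least three); or (one of $G,H$ is $K_2$ and the other has order at least three and contains a universal vertex); or ($G$ and $H$ are both triangle centered). (iv) $\gamma_{tR}(G\times H)=7$ if and only if both $G$ and $H$ have a universal vertex, one of $G$ and $H$ has exactly one universal vertex and the other one is not $K_2$, and at most one of $G$ and $H$ is triangle centered. (v) If at most one of $G$ and $H$ has a universal vertex, $\gamma_t(G)=\gamma_t(H)=2$, and $G$ and $H$ are not both triangle centered, then $\gamma_{tR}(G\times H)=8$.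
   Context: A universal vertex of $G$ is a vertex adjacent to all other vertices of $G$. $G$ is triangle centered if it contains a triangle $xyz$ such that every vertex of $G$ is adjacent to at least two vertices of $\{x,y,z\}$. $\gamma_t(G)$ is the minimum size of a set $D\subseteq V(G)$ such that every vertex of $G$ has a neighbor in $D$. A function $f:V(G)\to\{0,1,2\}$ with $V_i=f^{ -1}(i)$ is a total Roman dominating function if every vertex in $V_0$ has a neighbor in $V_2$ and the subgraph induced by $V_1\cup V_2$ has no isolated vertices; $\gamma_{tR}(G)$ is the minimum of $\sum_v f(v)$ over such $f$. The direct product $G\times H$ has vertex set $V(G)\times V(H)$, with $(g,h)(g',h')$ an edge iff $gg'\in E(G)$ and $hh'\in E(H)$. -}

module Defs where

open import Data.Nat using (ℕ; zero; suc; _+_; _*_; _≤_)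
open import Data.Fin using (Fin; remQuot)
open import Data.Fin.Subset using (Subset; _∈_; ∣_∣)
open import Data.Product using (Σ; ∃; ∃-syntax; _×_; _,_; proj₁; proj₂)
open import Data.Sum using (_⊎_)
open import Relation.Nullary using (¬_; Dec; ¬?)
open import Relation.Nullary.Decidable using (_×-dec_)
import Relation.Binary.PropositionalEquality as Eq
import Data.Fin as F
open import Relation.Binary.PropositionalEquality using (_≡_; _≢_)
open import Function.Bundles using (_↔_; Inverse)

record Graph (n : ℕ) : Set₁ where
  field
    Adj    : Fin n → Fin n → Set
    sym    : ∀ {x y} → Adj x y → Adj y x
    irrefl : ∀ {x} → ¬ Adj x x
    dec    : ∀ x y → Dec (Adj x y)
open Graph public

order : ∀ {n} → Graph n → ℕ
order {n} _ = n

NoIsolated : ∀ {n} → Graph n → Set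
NoIsolated {n} G = ∀ (v : Fin n) → ∃[ u ] Adj G v u

record Iso {n m} (G : Graph n) (H : Graph m) : Set where
  field
    bij : Fin n ↔ Fin m
    adj : ∀ x y → (Adj G x y → Adj H (Inverse.to bij x) (Inverse.to bij y))
                × (Adj H (Inverse.to bij x) (Inverse.to bij y) → Adj G x y)

K₂ : Graph 2
K₂ = record { Adj = λ x y → x ≢ y ; sym = λ p q → p (Eq.sym q)
            ; irrefl = λ p → p Eq.refl
            ; dec = λ x y → ¬? (x F.≟ y) }

IsK₂ : ∀ {n} → Graph n → Set
IsK₂ G = Iso G K₂

Universal : ∀ {n} → Graph n → Fin n → Set
Universal {n} G v = ∀ (u : Fin n) → u ≢ v → Adj G v u

HasUniversal : ∀ {n} → Graph n → Set
HasUniversal G = ∃[ v ] Universal G v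

AtLeastTwoUniversal : ∀ {n} → Graph n → Set
AtLeastTwoUniversal G = ∃[ u ] ∃[ v ] (u ≢ v × Universal G u × Universal G v)

ExactlyOneUniversal : ∀ {n} → Graph n → Set
ExactlyOneUniversal G = ∃[ v ] (Universal G v × (∀ w → Universal G w → w ≡ v))

TriangleCentered : ∀ {n} → Graph n → Set
TriangleCentered {n} G =
  ∃[ x ] ∃[ y ] ∃[ z ] (Adj G x y × Adj G y z × Adj G x z ×
    (∀ (v : Fin n) → (Adj G v x × Adj G v y) ⊎ (Adj G v x × Adj G v z) ⊎ (Adj G v y × Adj G v z)))

-- direct product G × H, on vertex set Fin (n * m) ≅ Fin n × Fin m via remQuot
-- (vertex p corresponds to the pair (π₁ p , π₂ p); remQuot is a bijection)
π₁ : ∀ {n m} → Fin (n * m) → Fin n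
π₁ {n} {m} p = proj₁ (remQuot {n} m p)

π₂ : ∀ {n m} → Fin (n * m) → Fin m
π₂ {n} {m} p = proj₂ (remQuot {n} m p)

_⊗_ : ∀ {n m} → Graph n → Graph m → Graph (n * m)
_⊗_ {n} {m} G H = record
  { Adj = λ p q → Adj G (π₁ {n} {m} p) (π₁ {n} {m} q) × Adj H (π₂ {n} {m} p) (π₂ {n} {m} q)
  ; sym = λ { (a , b) → sym G a , sym H b }
  ; irrefl = λ { (a , b) → irrefl G a }
  ; dec = λ p q → dec G (π₁ {n} {m} p) (π₁ {n} {m} q) ×-dec dec H (π₂ {n} {m} p) (π₂ {n} {m} q) }

sumFin : ∀ {n} → (Fin n → ℕ) → ℕ
sumFin {zero}  f = 0
sumFin {suc n} f = f F.zero + sumFin (λ i → f (F.suc i))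

data Label : Set where
  L0 L1 L2 : Label

val : Label → ℕ
val L0 = 0
val L1 = 1
val L2 = 2

weight : ∀ {n} → (Fin n → Label) → ℕ
weight f = sumFin (λ v → val (f v))

IsTRDF : ∀ {n} → Graph n → (Fin n → Label) → Set
IsTRDF {n} G f =
  (∀ (v : Fin n) → f v ≡ L0 → ∃[ u ] (Adj G v u × f u ≡ L2)) ×
  (∀ (v : Fin n) → f v ≢ L0 → ∃[ u ] (Adj G v u × f u ≢ L0))

IsγtR : ∀ {n} → Graph n → ℕ → Set
IsγtR {n} G k =
  (∃[ f ] (IsTRDF G f × weight f ≡ k)) ×
  (∀ (f : Fin n → Label) → IsTRDF G f → k ≤ weight f)

IsTDS : ∀ {n} → Graph n → Subset n → Set
IsTDS {n} G D = ∀ (v : Fin n) → ∃[ u ] (Adj G v u × u ∈ D)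

Isγt : ∀ {n} → Graph n → ℕ → Set
Isγt {n} G k =
  (∃[ D ] (IsTDS G D × ∣ D ∣ ≡ k)) ×
  (∀ (D : Subset n) → IsTDS G D → k ≤ ∣ D ∣)

module Submission where

-- Labellings of G ⊗ H, whose vertex set is Fin (n * m), are transferred to labellings f of
-- the grid Fin n × Fin m, where weights become double sums. The core is a single lower bound
-- ('lowerBound'): every TRDF has weight at least 4; at least 6 unless G ≅ H ≅ K₂; at least 7
-- unless condition (iii) holds; at least 8 unless moreover both graphs have a universal vertex.
-- It is proved by cases on the vertices labelled 2 (none, one, two — adjacent, apart, or in one
-- row or column — three, or more), each case combining a counting lemma for grid sums
-- ('Σ²-lowerBound') with structural facts about G and H. Explicit TRDFs give the matching upper
-- bounds ('UpperBounds'), and comparing the two proves each part ('Theorem').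

open import Defs
open import Data.Nat using (ℕ; zero; suc; _+_; _*_; _≤_; _≥_; _≤?_; z≤n; s≤s)
open import Data.Nat.Properties
  using (+-*-semiring; +-assoc; +-comm; +-identityʳ; *-zeroʳ; *-identityʳ;
         ≤-refl; ≤-reflexive; ≤-antisym; ≤-trans; m≤m+n; n≤1+n; <⇒≱;
         +-mono-≤; +-monoˡ-≤; *-mono-≤; *-monoˡ-≤; +-cancelʳ-≤)
open import Data.Nat.ListAction using (sum)
open import Algebra.Properties.Semiring.Sum +-*-semiring
  using (sum-cong-≗; ∑-distrib-+; ∑-comm; *-distribˡ-sum; *-distribʳ-sum) renaming (sum to sumᵥ)
open import Data.Bool using (Bool; true; false; if_then_else_; _∧_)
open import Data.Nat.Solver using (module +-*-Solver)
open import Data.Fin using (Fin; zero; suc; combine; _↑ˡ_; _↑ʳ_)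
open import Data.Fin.Patterns using (0F; 1F; 2F)
open import Data.Fin.Properties using (_≟_; all?; any?; ¬∀⟶∃¬; remQuot-combine; combine-remQuot)
open import Data.Fin.Subset using (Subset; ∣_∣)
open import Data.Fin.Permutation using (↔⇒≡)
open import Data.Product using (Σ; ∃-syntax; _×_; _,_; proj₁; proj₂; swap)
open import Data.Product.Properties using (≡-dec)
open import Data.Sum using (_⊎_; inj₁; inj₂; map₁; map₂) renaming (map to map⊎; swap to swap⊎)
open import Data.List using (List; []; _∷_; map)
open import Data.List.Membership.Propositional using (_∈_)
open import Data.List.Membership.Propositional.Properties using (∈-map⁺)
open import Data.List.Relation.Unary.Any using (Any; here; there)
open import Data.List.Relation.Unary.All as All using (All; []; _∷_)
open import Data.List.Relation.Unary.AllPairs using (AllPairs; []; _∷_)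
open import Data.Vec using ([]; _∷_; lookup)
open import Data.Vec.Properties using ([]=⇒lookup)
open import Data.Empty using (⊥; ⊥-elim)
open import Relation.Nullary using (¬_; Dec; yes; no)
open import Relation.Nullary.Decidable using (True; toWitness; _→-dec_; ¬?; _×-dec_)
open import Relation.Binary.PropositionalEquality
  using (_≡_; _≢_; ≢-sym; refl; cong; cong₂; trans; subst; subst₂; module ≡-Reasoning) renaming (sym to ≡-sym)
open import Function.Base using (_∘_)
open import Function.Bundles using (_⇔_; Inverse; mk⇔)
open import Function.Construct.Identity using (↔-id)

sumFin≡sumᵥ : ∀ {n} (F : Fin n → ℕ) → sumFin F ≡ sumᵥ F
sumFin≡sumᵥ {zero}  F = refl
sumFin≡sumᵥ {suc n} F = cong (F zero +_) (sumFin≡sumᵥ (λ i → F (suc i)))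

sumFin-cong : ∀ {n} {F G : Fin n → ℕ} → (∀ i → F i ≡ G i) → sumFin F ≡ sumFin G
sumFin-cong {F = F} {G} F≗G = trans (sumFin≡sumᵥ F) (trans (sum-cong-≗ F≗G) (≡-sym (sumFin≡sumᵥ G)))

sumFin-mono : ∀ {n} {F G : Fin n → ℕ} → (∀ i → F i ≤ G i) → sumFin F ≤ sumFin G
sumFin-mono {zero}  F≤G = z≤n
sumFin-mono {suc n} F≤G = +-mono-≤ (F≤G zero) (sumFin-mono (λ i → F≤G (suc i)))

sumFin-+ : ∀ {n} (F G : Fin n → ℕ) → sumFin (λ i → F i + G i) ≡ sumFin F + sumFin G
sumFin-+ F G = begin
  sumFin (λ i → F i + G i) ≡⟨ sumFin≡sumᵥ (λ i → F i + G i) ⟩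
  sumᵥ (λ i → F i + G i)   ≡⟨ ∑-distrib-+ F G ⟩
  sumᵥ F + sumᵥ G          ≡⟨ cong₂ _+_ (sumFin≡sumᵥ F) (sumFin≡sumᵥ G) ⟨
  sumFin F + sumFin G      ∎
  where open ≡-Reasoning

sumFin-const : ∀ {n} (c : ℕ) → sumFin {n} (λ _ → c) ≡ n * c
sumFin-const {zero}  c = refl
sumFin-const {suc n} c = cong (c +_) (sumFin-const {n} c)

sumFin-swap : ∀ {n m} (F : Fin n → Fin m → ℕ) →
              sumFin (λ i → sumFin (F i)) ≡ sumFin (λ j → sumFin (λ i → F i j))
sumFin-swap F = begin
  sumFin (λ i → sumFin (F i))         ≡⟨ sumFin-cong (λ i → sumFin≡sumᵥ (F i)) ⟩
  sumFin (λ i → sumᵥ (F i))           ≡⟨ sumFin≡sumᵥ (λ i → sumᵥ (F i)) ⟩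
  sumᵥ (λ i → sumᵥ (F i))             ≡⟨ ∑-comm F ⟩
  sumᵥ (λ j → sumᵥ (λ i → F i j))     ≡⟨ sumFin≡sumᵥ (λ j → sumᵥ (λ i → F i j)) ⟨
  sumFin (λ j → sumᵥ (λ i → F i j))   ≡⟨ sumFin-cong (λ j → sumFin≡sumᵥ (λ i → F i j)) ⟨
  sumFin (λ j → sumFin (λ i → F i j)) ∎
  where open ≡-Reasoning

sumFin-scaleˡ : ∀ {n} (c : ℕ) (F : Fin n → ℕ) → sumFin (λ i → c * F i) ≡ c * sumFin F
sumFin-scaleˡ c F =
  trans (sumFin≡sumᵥ (λ i → c * F i)) (≡-sym (trans (cong (c *_) (sumFin≡sumᵥ F)) (*-distribˡ-sum c F)))

sumFin-scaleʳ : ∀ {n} (c : ℕ) (F : Fin n → ℕ) → sumFin (λ i → F i * c) ≡ sumFin F * c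
sumFin-scaleʳ c F =
  trans (sumFin≡sumᵥ (λ i → F i * c)) (≡-sym (trans (cong (_* c) (sumFin≡sumᵥ F)) (*-distribʳ-sum c F)))

-- Boolean equality on Fin. It is defined by recursion rather than via the decision procedure _≟_
-- so that case analyses with _≟_ leave labellings defined by 'eqFin' untouched.
eqFin : ∀ {n} → Fin n → Fin n → Bool
eqFin zero    zero    = true
eqFin zero    (suc _) = false
eqFin (suc _) zero    = false
eqFin (suc a) (suc b) = eqFin a b

eqFin-refl : ∀ {n} (a : Fin n) → eqFin a a ≡ true
eqFin-refl zero    = refl
eqFin-refl (suc a) = eqFin-refl a

eqFin-≢ : ∀ {n} {a b : Fin n} → a ≢ b → eqFin a b ≡ false
eqFin-≢ {a = zero}  {zero}  a≢b = ⊥-elim (a≢b refl)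
eqFin-≢ {a = zero}  {suc b} _   = refl
eqFin-≢ {a = suc a} {zero}  _   = refl
eqFin-≢ {a = suc a} {suc b} a≢b = eqFin-≢ (λ a≡b → a≢b (cong suc a≡b))

eqFin-true : ∀ {n} {a b : Fin n} → eqFin a b ≡ true → a ≡ b
eqFin-true {a = zero}  {zero}  _  = refl
eqFin-true {a = suc a} {suc b} eq = cong suc (eqFin-true eq)

δ : ∀ {n} → Fin n → ℕ → Fin n → ℕ
δ a c i = if eqFin i a then c else 0

sumFin-δ : ∀ {n} (a : Fin n) c → sumFin (δ a c) ≡ c
sumFin-δ {suc n} zero    c = trans (cong (c +_) (trans (sumFin-const {n} 0) (*-zeroʳ n))) (+-identityʳ c)
sumFin-δ {suc n} (suc a) c = sumFin-δ a c

zeroAt : ∀ {n} → Fin n → (Fin n → ℕ) → Fin n → ℕ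
zeroAt a F i = if eqFin i a then 0 else F i

sumFin-split : ∀ {n} (a : Fin n) (F : Fin n → ℕ) → sumFin F ≡ F a + sumFin (zeroAt a F)
sumFin-split {suc n} zero    F = refl
sumFin-split {suc n} (suc a) F = begin
  F zero + sumFin (λ i → F (suc i))             ≡⟨ cong (F zero +_) (sumFin-split a (λ i → F (suc i))) ⟩
  F zero + (F (suc a) + rest)                   ≡⟨ +-assoc (F zero) _ _ ⟨
  F zero + F (suc a) + rest                     ≡⟨ cong (_+ rest) (+-comm (F zero) (F (suc a))) ⟩
  F (suc a) + F zero + rest                     ≡⟨ +-assoc (F (suc a)) _ _ ⟩
  F (suc a) + (F zero + rest)                   ∎
  where
  open ≡-Reasoning
  rest : ℕ
  rest = sumFin (zeroAt a (λ i → F (suc i)))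

sumFin-combine : ∀ {n m} (F : Fin (n * m) → ℕ) →
                 sumFin F ≡ sumFin {n} (λ g → sumFin {m} (λ h → F (combine {n} {m} g h)))
sumFin-combine {zero}      F = refl
sumFin-combine {suc n} {m} F =
  trans (sumFin-++ m F) (cong (sumFin (λ h → F (h ↑ˡ (n * m))) +_) (sumFin-combine {n} {m} (λ p → F (m ↑ʳ p))))
  where
  sumFin-++ : ∀ k {l} (F : Fin (k + l) → ℕ) →
              sumFin F ≡ sumFin (λ i → F (i ↑ˡ l)) + sumFin (λ j → F (k ↑ʳ j))
  sumFin-++ zero    F = refl
  sumFin-++ (suc k) F = trans (cong (F zero +_) (sumFin-++ k (λ i → F (suc i)))) (≡-sym (+-assoc (F zero) _ _))

module _ {n m : ℕ} where

  V : Set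
  V = Fin n × Fin m

  Σ² : (V → ℕ) → ℕ
  Σ² F = sumFin {n} (λ g → sumFin {m} (λ h → F (g , h)))

  Σ²-cong : {F G : V → ℕ} → (∀ v → F v ≡ G v) → Σ² F ≡ Σ² G
  Σ²-cong F≗G = sumFin-cong {n} (λ g → sumFin-cong {m} (λ h → F≗G (g , h)))

  Σ²-mono : {F G : V → ℕ} → (∀ v → F v ≤ G v) → Σ² F ≤ Σ² G
  Σ²-mono F≤G = sumFin-mono {n} (λ g → sumFin-mono {m} (λ h → F≤G (g , h)))

  Σ²-+ : (F G : V → ℕ) → Σ² (λ v → F v + G v) ≡ Σ² F + Σ² G
  Σ²-+ F G = trans (sumFin-cong (λ g → sumFin-+ (λ h → F (g , h)) (λ h → G (g , h)))) (sumFin-+ {n} _ _)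

  Σ²-const : (c : ℕ) → Σ² (λ _ → c) ≡ n * (m * c)
  Σ²-const c = trans (sumFin-cong {n} (λ g → sumFin-const {m} c)) (sumFin-const {n} (m * c))

  Σ²-zero : Σ² (λ _ → 0) ≡ 0
  Σ²-zero = trans (Σ²-const 0) (trans (cong (n *_) (*-zeroʳ m)) (*-zeroʳ n))

  row : Fin n → V → ℕ
  row a v = δ a 1 (proj₁ v)

  col : Fin m → V → ℕ
  col b v = δ b 1 (proj₂ v)

  Σ²-row : (a : Fin n) → Σ² (row a) ≡ m
  Σ²-row a = trans (sumFin-cong (λ g → trans (sumFin-const {m} (δ a 1 g)) (m*δ g))) (sumFin-δ a m)
    where
    m*δ : ∀ g → m * δ a 1 g ≡ δ a m g
    m*δ g with eqFin g a
    ... | true  = *-identityʳ m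
    ... | false = *-zeroʳ m

  Σ²-col : (b : Fin m) → Σ² (col b) ≡ n
  Σ²-col b = trans (sumFin-cong {n} (λ g → sumFin-δ b 1)) (trans (sumFin-const {n} 1) (*-identityʳ n))

  eqV : V → V → Bool
  eqV (g , h) (a , b) = eqFin g a ∧ eqFin h b

  eqV-refl : (p : V) → eqV p p ≡ true
  eqV-refl (a , b) rewrite eqFin-refl a | eqFin-refl b = refl

  eqV-≢ : {v p : V} → v ≢ p → eqV v p ≡ false
  eqV-≢ {g , h} {a , b} v≢p with eqFin g a in g≟a | eqFin h b in h≟b
  ... | false | _     = refl
  ... | true  | false = refl
  ... | true  | true  = ⊥-elim (v≢p (cong₂ _,_ (eqFin-true g≟a) (eqFin-true h≟b)))

  eqV-true : {v p : V} → eqV v p ≡ true → v ≡ p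
  eqV-true {g , h} {a , b} eq with eqFin g a in g≟a | eqFin h b in h≟b | eq
  ... | true  | true  | _  = cong₂ _,_ (eqFin-true g≟a) (eqFin-true h≟b)
  ... | true  | false | ()
  ... | false | _     | ()

  point : V → ℕ → V → ℕ
  point p c v = if eqV v p then c else 0

  zeroAt² : V → (V → ℕ) → V → ℕ
  zeroAt² p F v = if eqV v p then 0 else F v

  Σ²-split : (p : V) (F : V → ℕ) → Σ² F ≡ F p + Σ² (zeroAt² p F)
  Σ²-split (a , b) F = begin
    Σ² F                                           ≡⟨ sumFin-split a R ⟩
    R a + sumFin (zeroAt a R)                      ≡⟨ cong (_+ sumFin (zeroAt a R)) (sumFin-split b (λ h → F (a , h))) ⟩
    F (a , b) + rowRest + sumFin (zeroAt a R)      ≡⟨ +-assoc (F (a , b)) _ _ ⟩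
    F (a , b) + (rowRest + sumFin (zeroAt a R))    ≡⟨ cong (F (a , b) +_) R'-split ⟨
    F (a , b) + Σ² (zeroAt² (a , b) F)             ∎
    where
    open ≡-Reasoning
    R R' : Fin n → ℕ
    R  g = sumFin (λ h → F (g , h))
    R' g = sumFin (λ h → zeroAt² (a , b) F (g , h))
    rowRest : ℕ
    rowRest = sumFin (zeroAt b (λ h → F (a , h)))
    R'a : R' a ≡ rowRest
    R'a rewrite eqFin-refl a = refl
    R'-off-a : ∀ g → zeroAt a R' g ≡ zeroAt a R g
    R'-off-a g with eqFin g a
    ... | true  = refl
    ... | false = refl
    R'-split : sumFin R' ≡ rowRest + sumFin (zeroAt a R)
    R'-split = trans (sumFin-split a R') (cong₂ _+_ R'a (sumFin-cong R'-off-a))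

  Σ²-point : (p : V) (c : ℕ) → Σ² (point p c) ≡ c
  Σ²-point p c = begin
    Σ² (point p c)                           ≡⟨ Σ²-split p (point p c) ⟩
    point p c p + Σ² (zeroAt² p (point p c)) ≡⟨ cong₂ _+_ at-p (trans (Σ²-cong elsewhere) Σ²-zero) ⟩
    c + 0                                    ≡⟨ +-identityʳ c ⟩
    c                                        ∎
    where
    open ≡-Reasoning
    at-p : point p c p ≡ c
    at-p rewrite eqV-refl p = refl
    elsewhere : ∀ v → zeroAt² p (point p c) v ≡ 0
    elsewhere v with eqV v p
    ... | true  = refl
    ... | false = refl

  Σ²-lowerBound : (ℓ F : V → ℕ) → (∀ v → ℓ v ≤ F v) → (ps : List (V × ℕ)) →
                  AllPairs _≢_ (map proj₁ ps) →
                  All (λ (p , k) → k + ℓ p ≤ F p) ps →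
                  Σ² ℓ + sum (map proj₂ ps) ≤ Σ² F
  Σ²-lowerBound ℓ F ℓ≤F [] [] [] = subst (_≤ Σ² F) (≡-sym (+-identityʳ (Σ² ℓ))) (Σ²-mono ℓ≤F)
  Σ²-lowerBound ℓ F ℓ≤F ((p , k) ∷ ps) (p∉ps ∷ distinct) (bonus ∷ bonuses) =
    subst₂ _≤_ (≡-sym regroup) (≡-sym (Σ²-split p F)) (+-mono-≤ bonus rest)
    where
    ℓ≤F' : ∀ v → zeroAt² p ℓ v ≤ zeroAt² p F v
    ℓ≤F' v with eqV v p
    ... | true  = z≤n
    ... | false = ℓ≤F v
    bonuses' : ∀ {qs : List (V × ℕ)} → All (p ≢_) (map proj₁ qs) → All (λ (q , j) → j + ℓ q ≤ F q) qs →
               All (λ (q , j) → j + zeroAt² p ℓ q ≤ zeroAt² p F q) qs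
    bonuses' {[]}          []            []       = []
    bonuses' {(q , j) ∷ _} (p≢q ∷ p≢qs) (b ∷ bs) =
      subst (λ q≟p → j + (if q≟p then 0 else ℓ q) ≤ (if q≟p then 0 else F q))
            (≡-sym (eqV-≢ (λ q≡p → p≢q (≡-sym q≡p)))) b
      ∷ bonuses' p≢qs bs
    rest : Σ² (zeroAt² p ℓ) + sum (map proj₂ ps) ≤ Σ² (zeroAt² p F)
    rest = Σ²-lowerBound (zeroAt² p ℓ) (zeroAt² p F) ℓ≤F' ps distinct (bonuses' p∉ps bonuses)
    regroup : Σ² ℓ + (k + sum (map proj₂ ps)) ≡ (k + ℓ p) + (Σ² (zeroAt² p ℓ) + sum (map proj₂ ps))
    regroup rewrite Σ²-split p ℓ = solve 4 (λ a b c d → a :+ c :+ (b :+ d) := (b :+ a) :+ (c :+ d)) refl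
                                     (ℓ p) k (Σ² (zeroAt² p ℓ)) (sum (map proj₂ ps))
      where open +-*-Solver

  Σ²-points : (F : V → ℕ) (ps : List (V × ℕ)) → AllPairs _≢_ (map proj₁ ps) →
              All (λ (p , k) → k ≤ F p) ps → sum (map proj₂ ps) ≤ Σ² F
  Σ²-points F ps distinct bounds =
    subst (_≤ Σ² F) (cong (_+ sum (map proj₂ ps)) Σ²-zero)
      (Σ²-lowerBound (λ _ → 0) F (λ _ → z≤n) ps distinct (padded bounds))
    where
    padded : ∀ {qs : List (V × ℕ)} → All (λ (q , j) → j ≤ F q) qs → All (λ (q , j) → j + 0 ≤ F q) qs
    padded []       = []
    padded (b ∷ bs) = subst (_≤ _) (≡-sym (+-identityʳ _)) b ∷ padded bs

_≟V_ : ∀ {n m} → (v w : V {n} {m}) → Dec (v ≡ w)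
_≟V_ = ≡-dec _≟_ _≟_

any-cell? : ∀ {n m} {P : V {n} {m} → Set} → (∀ v → Dec (P v)) → Dec (Σ (V {n} {m}) P)
any-cell? P? with any? (λ g → any? (λ h → P? (g , h)))
... | yes (g , h , p) = yes ((g , h) , p)
... | no ¬p           = no λ ((g , h) , p) → ¬p (g , h , p)

≢row : ∀ {n m} {v w : V {n} {m}} → proj₁ v ≢ proj₁ w → v ≢ w
≢row g≢g' refl = g≢g' refl

≢col : ∀ {n m} {v w : V {n} {m}} → proj₂ v ≢ proj₂ w → v ≢ w
≢col h≢h' refl = h≢h' refl

Σ²-transpose : ∀ {n m} (F : V {n} {m} → ℕ) → Σ² F ≡ Σ² {m} {n} (λ (h , g) → F (g , h))
Σ²-transpose F = sumFin-swap (λ g h → F (g , h))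

_≟L_ : (a b : Label) → Dec (a ≡ b)
L0 ≟L L0 = yes refl
L1 ≟L L1 = yes refl
L2 ≟L L2 = yes refl
L0 ≟L L1 = no λ ()
L0 ≟L L2 = no λ ()
L1 ≟L L0 = no λ ()
L1 ≟L L2 = no λ ()
L2 ≟L L0 = no λ ()
L2 ≟L L1 = no λ ()

two⇒nonzero : ∀ {l} → l ≡ L2 → l ≢ L0
two⇒nonzero refl ()

one⇒nonzero : ∀ {l} → l ≡ L1 → l ≢ L0
one⇒nonzero refl ()

Adj× : ∀ {n m} (G : Graph n) (H : Graph m) → V {n} {m} → V {n} {m} → Set
Adj× G H (g , h) (g' , h') = Adj G g g' × Adj H h h'

NbrWith : ∀ {n m} (G : Graph n) (H : Graph m) → (Label → Set) → (V {n} {m} → Label) → V {n} {m} → Set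
NbrWith {n} {m} G H P f v = Σ (V {n} {m}) λ w → Adj× G H v w × P (f w)

TRDF× : ∀ {n m} (G : Graph n) (H : Graph m) → (V {n} {m} → Label) → Set
TRDF× G H f = (∀ v → f v ≡ L0 → NbrWith G H (_≡ L2) f v) × (∀ v → f v ≢ L0 → NbrWith G H (_≢ L0) f v)

wt : ∀ {n m} → (V {n} {m} → Label) → ℕ
wt f = Σ² (λ v → val (f v))

Achievable : ∀ {n m} (G : Graph n) (H : Graph m) → ℕ → Set
Achievable {n} {m} G H k = Σ (V {n} {m} → Label) λ f → TRDF× G H f × wt f ≤ k

Bounded : ∀ {n m} (G : Graph n) (H : Graph m) → ℕ → Set
Bounded G H k = ∀ f → TRDF× G H f → k ≤ wt f

module _ {n m} (G : Graph n) (H : Graph m) (f : V {n} {m} → Label) where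

  transpose-TRDF : TRDF× G H f → TRDF× H G (f ∘ swap)
  transpose-TRDF (dom₀ , dom₊) = (λ w l → transposeNbr {_≡ L2} (dom₀ (swap w) l)) ,
                                 (λ w l → transposeNbr {_≢ L0} (dom₊ (swap w) l))
    where
    transposeNbr : ∀ {P w} → NbrWith G H P f (swap w) → NbrWith H G P (f ∘ swap) w
    transposeNbr (u , (g~ , h~) , p) = swap u , (h~ , g~) , p

  transpose-wt : wt (f ∘ swap) ≡ wt f
  transpose-wt = ≡-sym (Σ²-transpose (λ v → val (f v)))

transpose-Achievable : ∀ {n m} (G : Graph n) (H : Graph m) k → Achievable H G k → Achievable G H k
transpose-Achievable G H k (f , tr , w≤k) =
  f ∘ swap , transpose-TRDF H G f tr , subst (_≤ k) (≡-sym (transpose-wt H G f)) w≤k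

module Transfer {n m} (G : Graph n) (H : Graph m) where

  π-combine : ∀ (g : Fin n) (h : Fin m) → (π₁ {n} {m} (combine g h) , π₂ {n} {m} (combine g h)) ≡ (g , h)
  π-combine g h = remQuot-combine g h

  toGrid : (Fin (n * m) → Label) → V {n} {m} → Label
  toGrid F (g , h) = F (combine g h)

  fromGrid : (V {n} {m} → Label) → Fin (n * m) → Label
  fromGrid f p = f (π₁ {n} {m} p , π₂ {n} {m} p)

  weight-toGrid : ∀ F → weight F ≡ wt (toGrid F)
  weight-toGrid F = sumFin-combine {n} {m} (λ p → val (F p))

  weight-fromGrid : ∀ f → weight (fromGrid f) ≡ wt f
  weight-fromGrid f = trans (sumFin-combine {n} {m} (λ p → val (fromGrid f p)))
    (sumFin-cong {n} (λ g → sumFin-cong {m} (λ h → cong (λ v → val (f v)) (π-combine g h))))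

  toGrid-nbr : ∀ {P} F g h → ∃[ u ] (Adj (G ⊗ H) (combine g h) u × P (F u)) → NbrWith G H P (toGrid F) (g , h)
  toGrid-nbr {P} F g h (u , (g~ , h~) , p) =
    (π₁ {n} {m} u , π₂ {n} {m} u) ,
    (subst (λ v → Adj× G H v (π₁ {n} {m} u , π₂ {n} {m} u)) (π-combine g h) (g~ , h~)) ,
    subst (λ x → P (F x)) (≡-sym (combine-remQuot {n} m u)) p

  fromGrid-nbr : ∀ {P} f p → NbrWith G H P f (π₁ {n} {m} p , π₂ {n} {m} p) → ∃[ u ] (Adj (G ⊗ H) p u × P (fromGrid f u))
  fromGrid-nbr {P} f p ((g , h) , p~ , q) =
    combine g h ,
    subst (Adj× G H (π₁ {n} {m} p , π₂ {n} {m} p)) (≡-sym (π-combine g h)) p~ ,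
    subst (λ v → P (f v)) (≡-sym (π-combine g h)) q

  toGrid-TRDF : ∀ F → IsTRDF (G ⊗ H) F → TRDF× G H (toGrid F)
  toGrid-TRDF F (dom₀ , dom₊) =
    (λ (g , h) F≡0 → toGrid-nbr {_≡ L2} F g h (dom₀ (combine g h) F≡0)) ,
    (λ (g , h) F≢0 → toGrid-nbr {_≢ L0} F g h (dom₊ (combine g h) F≢0))

  fromGrid-TRDF : ∀ f → TRDF× G H f → IsTRDF (G ⊗ H) (fromGrid f)
  fromGrid-TRDF f (dom₀ , dom₊) = (λ p f≡0 → fromGrid-nbr {_≡ L2} f p (dom₀ _ f≡0)) ,
                                (λ p f≢0 → fromGrid-nbr {_≢ L0} f p (dom₊ _ f≢0))

  fromIsγtR : ∀ {k} → IsγtR (G ⊗ H) k → (Σ (V {n} {m} → Label) λ f → TRDF× G H f × wt f ≡ k) × Bounded G H k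
  fromIsγtR ((F , tr , wF≡k) , minimal) =
    (toGrid F , toGrid-TRDF F tr , trans (≡-sym (weight-toGrid F)) wF≡k) ,
    λ f tr → subst (_ ≤_) (weight-fromGrid f) (minimal (fromGrid f) (fromGrid-TRDF f tr))

  toIsγtR : ∀ {k} → Achievable G H k → Bounded G H k → IsγtR (G ⊗ H) k
  toIsγtR {k} (f , tr , wf≤k) bound =
    (fromGrid f , fromGrid-TRDF f tr , trans (weight-fromGrid f) (≤-antisym wf≤k (bound f tr))) ,
    λ F tr → subst (k ≤_) (≡-sym (weight-toGrid F)) (bound (toGrid F) (toGrid-TRDF F tr))

adj⇒≢ : ∀ {n} (G : Graph n) {a b} → Adj G a b → a ≢ b
adj⇒≢ G a~b refl = irrefl G a~b

two-distinct⇒2≤ : ∀ {n} {a b : Fin n} → a ≢ b → 2 ≤ n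
two-distinct⇒2≤ {suc zero}    {zero} {zero} a≢b = ⊥-elim (a≢b refl)
two-distinct⇒2≤ {suc (suc n)} _ = s≤s (s≤s z≤n)

three-distinct⇒3≤ : ∀ {n} {a b c : Fin n} → a ≢ b → a ≢ c → b ≢ c → 3 ≤ n
three-distinct⇒3≤ {suc zero}          {zero} {zero}                      a≢b _   _   = ⊥-elim (a≢b refl)
three-distinct⇒3≤ {suc (suc zero)}    {zero}     {zero}                  a≢b _   _   = ⊥-elim (a≢b refl)
three-distinct⇒3≤ {suc (suc zero)}    {zero}     {suc zero} {zero}       _   a≢c _   = ⊥-elim (a≢c refl)
three-distinct⇒3≤ {suc (suc zero)}    {zero}     {suc zero} {suc zero}   _   _   b≢c = ⊥-elim (b≢c refl)
three-distinct⇒3≤ {suc (suc zero)}    {suc zero} {zero}     {zero}       _   _   b≢c = ⊥-elim (b≢c refl)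
three-distinct⇒3≤ {suc (suc zero)}    {suc zero} {zero}     {suc zero}   _   a≢c _   = ⊥-elim (a≢c refl)
three-distinct⇒3≤ {suc (suc zero)}    {suc zero} {suc zero}              a≢b _   _   = ⊥-elim (a≢b refl)
three-distinct⇒3≤ {suc (suc (suc n))} _ _ _ = s≤s (s≤s (s≤s z≤n))

noIsolated⇒2≤ : ∀ {n} (G : Graph n) → NoIsolated G → Fin n → 2 ≤ n
noIsolated⇒2≤ G noIso g = two-distinct⇒2≤ (adj⇒≢ G (proj₂ (noIso g)))

2≤⇒2or3≤ : ∀ {k} → 2 ≤ k → k ≡ 2 ⊎ 3 ≤ k
2≤⇒2or3≤ {suc (suc zero)}    _ = inj₁ refl
2≤⇒2or3≤ {suc (suc (suc k))} _ = inj₂ (s≤s (s≤s (s≤s z≤n)))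
2≤⇒2or3≤ {suc zero}          (s≤s ())

2≤⇒2or3or4≤ : ∀ {k} → 2 ≤ k → k ≡ 2 ⊎ k ≡ 3 ⊎ 4 ≤ k
2≤⇒2or3or4≤ {suc (suc zero)}          _ = inj₁ refl
2≤⇒2or3or4≤ {suc (suc (suc zero))}    _ = inj₂ (inj₁ refl)
2≤⇒2or3or4≤ {suc (suc (suc (suc k)))} _ = inj₂ (inj₂ (s≤s (s≤s (s≤s (s≤s z≤n)))))
2≤⇒2or3or4≤ {suc zero}                (s≤s ())

universal? : ∀ {n} (G : Graph n) v → Dec (Universal G v)
universal? G v = all? (λ u → ¬? (u ≟ v) →-dec dec G v u)

nonNeighbour : ∀ {n} (G : Graph n) {v} → ¬ Universal G v → Σ (Fin n) λ u → u ≢ v × ¬ Adj G v u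
nonNeighbour {n} G {v} ¬univ with ¬∀⟶∃¬ n _ (λ u → ¬? (u ≟ v) →-dec dec G v u) ¬univ
... | u , ¬imp = u , (λ u≡v → ¬imp (λ u≢v → ⊥-elim (u≢v u≡v))) , (λ v~u → ¬imp (λ _ → v~u))

atLeastTwoUniversal? : ∀ {k} (X : Graph k) → Dec (AtLeastTwoUniversal X)
atLeastTwoUniversal? X = any? (λ u → any? (λ v → ¬? (u ≟ v) ×-dec universal? X u ×-dec universal? X v))

exactlyOne⇒¬atLeastTwo : ∀ {k} (X : Graph k) → ExactlyOneUniversal X → ¬ AtLeastTwoUniversal X
exactlyOne⇒¬atLeastTwo X (u , _ , unique) (a , b , a≢b , Ua , Ub) = a≢b (trans (unique a Ua) (≡-sym (unique b Ub)))

uniqueUniversal : ∀ {k} (X : Graph k) → HasUniversal X → ¬ AtLeastTwoUniversal X → ExactlyOneUniversal X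
uniqueUniversal X (u , U) ¬two = u , U , unique
  where
  unique : ∀ w → Universal X w → w ≡ u
  unique w W with w ≟ u
  ... | yes w≡u = w≡u
  ... | no  w≢u = ⊥-elim (¬two (w , u , w≢u , W , U))

order2-adj : (G : Graph 2) → NoIsolated G → ∀ x y → x ≢ y → Adj G x y
order2-adj G noIso x y x≢y with noIso x
... | u , x~u = subst (Adj G x) (other x≢y (λ u≡x → adj⇒≢ G x~u (≡-sym u≡x))) x~u
  where
  other : ∀ {x y u : Fin 2} → x ≢ y → u ≢ x → u ≡ y
  other {zero}     {zero}                x≢y _   = ⊥-elim (x≢y refl)
  other {zero}     {suc zero} {zero}     _   u≢x = ⊥-elim (u≢x refl)
  other {zero}     {suc zero} {suc zero} _   _   = refl
  other {suc zero} {zero}     {zero}     _   _   = refl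
  other {suc zero} {zero}     {suc zero} _   u≢x = ⊥-elim (u≢x refl)
  other {suc zero} {suc zero}            x≢y _   = ⊥-elim (x≢y refl)

order2⇒K₂ : ∀ {n} (G : Graph n) → NoIsolated G → n ≡ 2 → IsK₂ G
order2⇒K₂ G noIso refl =
  record { bij = ↔-id (Fin 2) ; adj = λ x y → adj⇒≢ G , order2-adj G noIso x y }

K₂⇒order2 : ∀ {n} (G : Graph n) → IsK₂ G → n ≡ 2
K₂⇒order2 G iso = ↔⇒≡ (Iso.bij iso)

order2⇒universal : ∀ {n} (G : Graph n) → NoIsolated G → n ≡ 2 → ∀ v → Universal G v
order2⇒universal G noIso refl v u u≢v = order2-adj G noIso v u (λ v≡u → u≢v (≡-sym v≡u))

order2⇒twoUniversal : ∀ {n} (G : Graph n) → NoIsolated G → n ≡ 2 → AtLeastTwoUniversal G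
order2⇒twoUniversal G noIso refl =
  zero , suc zero , (λ ()) , order2⇒universal G noIso refl zero , order2⇒universal G noIso refl (suc zero)

order2⇒hasUniversal : ∀ {n} (G : Graph n) → NoIsolated G → n ≡ 2 → HasUniversal G
order2⇒hasUniversal G noIso refl = zero , order2⇒universal G noIso refl zero

-- A graph of order 3 without isolated vertices is a path or a triangle, so it has a universal vertex.
order3⇒hasUniversal : ∀ {n} (G : Graph n) → NoIsolated G → n ≡ 3 → HasUniversal G
order3⇒hasUniversal G noIso refl with dec G 0F 1F | dec G 0F 2F
... | yes 0~1 | yes 0~2 = 0F , λ { 0F 0≢0 → ⊥-elim (0≢0 refl) ; 1F _ → 0~1 ; 2F _ → 0~2 }
... | yes 0~1 | no 0≁2  = 1F , λ { 0F _ → sym G 0~1 ; 1F 1≢1 → ⊥-elim (1≢1 refl) ; 2F _ → 1~2 }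
  where
  1~2 : Adj G 1F 2F
  1~2 with noIso 2F
  ... | 0F , 2~0 = ⊥-elim (0≁2 (sym G 2~0))
  ... | 1F , 2~1 = sym G 2~1
  ... | 2F , 2~2 = ⊥-elim (irrefl G 2~2)
... | no 0≁1  | yes 0~2 = 2F , λ { 0F _ → sym G 0~2 ; 1F _ → 2~1 ; 2F 2≢2 → ⊥-elim (2≢2 refl) }
  where
  2~1 : Adj G 2F 1F
  2~1 with noIso 1F
  ... | 0F , 1~0 = ⊥-elim (0≁1 (sym G 1~0))
  ... | 1F , 1~1 = ⊥-elim (irrefl G 1~1)
  ... | 2F , 1~2 = sym G 1~2
... | no 0≁1  | no 0≁2 with noIso 0F
...   | 0F , 0~0 = ⊥-elim (irrefl G 0~0)
...   | 1F , 0~1 = ⊥-elim (0≁1 0~1)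
...   | 2F , 0~2 = ⊥-elim (0≁2 0~2)

module _ {n m : ℕ} where

  assign : List (V {n} {m} × Label) → V {n} {m} → Label
  assign []             v = L0
  assign ((p , l) ∷ ps) v = if eqV v p then l else assign ps v

  assign-at : ∀ ps {p l} → AllPairs _≢_ (map proj₁ ps) → (p , l) ∈ ps → assign ps p ≡ l
  assign-at ((p , l) ∷ ps) _ (here refl) rewrite eqV-refl p = refl
  assign-at ((q , k) ∷ ps) {p} (q∉ps ∷ distinct) (there p∈ps)
    rewrite eqV-≢ {v = p} {p = q} (λ p≡q → All.lookup q∉ps (∈-map⁺ proj₁ p∈ps) (≡-sym p≡q)) = assign-at ps distinct p∈ps

  assign-support : ∀ ps v → assign ps v ≢ L0 → Any (λ q → v ≡ proj₁ q) ps
  assign-support []             v l≢0 = ⊥-elim (l≢0 refl)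
  assign-support ((p , l) ∷ ps) v l≢0 with eqV v p in v≟p
  ... | true  = here (eqV-true v≟p)
  ... | false = there (assign-support ps v l≢0)

  wt-assign : ∀ ps → wt (assign ps) ≤ sum (map (λ q → val (proj₂ q)) ps)
  wt-assign ps = subst (wt (assign ps) ≤_) (Σ²-masses ps) (Σ²-mono (val≤masses ps))
    where
    masses : List (V × Label) → V → ℕ
    masses []             v = 0
    masses ((p , l) ∷ ps) v = point p (val l) v + masses ps v
    val≤masses : ∀ ps v → val (assign ps v) ≤ masses ps v
    val≤masses []             v = z≤n
    val≤masses ((p , l) ∷ ps) v with eqV v p
    ... | true  = m≤m+n _ _
    ... | false = val≤masses ps v
    Σ²-masses : ∀ ps → Σ² (masses ps) ≡ sum (map (λ q → val (proj₂ q)) ps)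
    Σ²-masses []             = Σ²-zero {n} {m}
    Σ²-masses ((p , l) ∷ ps) = trans (Σ²-+ (point p (val l)) (masses ps)) (cong₂ _+_ (Σ²-point p (val l)) (Σ²-masses ps))

dominated⇒TRDF : ∀ {n m} (G : Graph n) (H : Graph m) f → (∀ v → NbrWith G H (_≡ L2) f v) → TRDF× G H f
dominated⇒TRDF G H f nbr = (λ v _ → nbr v) , (λ v _ → let (w , v~w , fw≡2) = nbr v in w , v~w , two⇒nonzero fw≡2)

rectangle : ∀ {n m} → Subset n → Subset m → V {n} {m} → Label
rectangle D D' (g , h) = if lookup D g ∧ lookup D' h then L2 else L0

wt-rectangle : ∀ {n m} (D : Subset n) (D' : Subset m) → wt (rectangle D D') ≡ ∣ D ∣ * (∣ D' ∣ * 2)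
wt-rectangle D D' = begin
  wt (rectangle D D')                                           ≡⟨ sumFin-cong (λ g → sumFin-cong (val-rectangle g)) ⟩
  sumFin (λ g → sumFin (λ h → ind (lookup D g) * (ind (lookup D' h) * 2)))
    ≡⟨ sumFin-cong (λ g → sumFin-scaleˡ (ind (lookup D g)) (λ h → ind (lookup D' h) * 2)) ⟩
  sumFin (λ g → ind (lookup D g) * sumFin (λ h → ind (lookup D' h) * 2))
    ≡⟨ sumFin-cong (λ g → cong (ind (lookup D g) *_) (sumFin-scaleʳ 2 (λ h → ind (lookup D' h)))) ⟩
  sumFin (λ g → ind (lookup D g) * (sumFin (λ h → ind (lookup D' h)) * 2))
    ≡⟨ sumFin-scaleʳ (sumFin (λ h → ind (lookup D' h)) * 2) (λ g → ind (lookup D g)) ⟩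
  sumFin (λ g → ind (lookup D g)) * (sumFin (λ h → ind (lookup D' h)) * 2)
    ≡⟨ cong₂ (λ a b → a * (b * 2)) (count D) (count D') ⟩
  ∣ D ∣ * (∣ D' ∣ * 2)                                          ∎
  where
  open ≡-Reasoning
  ind : Bool → ℕ
  ind true  = 1
  ind false = 0
  count : ∀ {k} (S : Subset k) → sumFin (λ i → ind (lookup S i)) ≡ ∣ S ∣
  count []          = refl
  count (true ∷ S)  = cong suc (count S)
  count (false ∷ S) = count S
  val-rectangle : ∀ g h → val (rectangle D D' (g , h)) ≡ ind (lookup D g) * (ind (lookup D' h) * 2)
  val-rectangle g h with lookup D g | lookup D' h
  ... | true  | true  = refl
  ... | true  | false = refl
  ... | false | _     = refl

module UpperBounds {n m} (G : Graph n) (H : Graph m) where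

  allOnes : NoIsolated G → NoIsolated H → Achievable G H (n * (m * 1))
  allOnes noG noH = (λ _ → L1) , ((λ _ ()) , nbr) , ≤-reflexive (Σ²-const {n} {m} 1)
    where
    nbr : ∀ v → L1 ≢ L0 → NbrWith G H (_≢ L0) (λ _ → L1) v
    nbr (g , h) _ = (proj₁ (noG g) , proj₁ (noH h)) , (proj₂ (noG g) , proj₂ (noH h)) , one⇒nonzero refl

  twoUniversal⇒6 : AtLeastTwoUniversal G → AtLeastTwoUniversal H → Achievable G H 6
  twoUniversal⇒6 (u₁ , u₂ , u₁≢u₂ , U₁ , U₂) (v₁ , v₂ , v₁≢v₂ , V₁ , V₂) = f , (dom₀ , dom₊) , wt-assign ps
    where
    u₁~u₂ : Adj G u₁ u₂
    u₁~u₂ = sym G (U₂ u₁ u₁≢u₂)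
    v₁~v₂ : Adj H v₁ v₂
    v₁~v₂ = sym H (V₂ v₁ v₁≢v₂)
    ps : List (V × Label)
    ps = ((u₁ , v₁) , L2) ∷ ((u₂ , v₂) , L2) ∷ ((u₁ , v₂) , L1) ∷ ((u₂ , v₁) , L1) ∷ []
    distinct : AllPairs _≢_ (map proj₁ ps)
    distinct = (≢row u₁≢u₂ ∷ ≢col v₁≢v₂ ∷ ≢row u₁≢u₂ ∷ [])
             ∷ (≢row (≢-sym u₁≢u₂) ∷ ≢col (≢-sym v₁≢v₂) ∷ []) ∷ (≢row u₁≢u₂ ∷ []) ∷ [] ∷ []
    f : V → Label
    f = assign ps
    f₁₁ : f (u₁ , v₁) ≡ L2
    f₁₁ = assign-at ps distinct (here refl)
    f₂₂ : f (u₂ , v₂) ≡ L2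
    f₂₂ = assign-at ps distinct (there (here refl))
    f₁₂ : f (u₁ , v₂) ≡ L1
    f₁₂ = assign-at ps distinct (there (there (here refl)))
    f₂₁ : f (u₂ , v₁) ≡ L1
    f₂₁ = assign-at ps distinct (there (there (there (here refl))))
    dom₀ : ∀ v → f v ≡ L0 → NbrWith G H (_≡ L2) f v
    dom₀ (g , h) fv≡0 with g ≟ u₁ | h ≟ v₁
    ... | no g≢u₁ | no h≢v₁ = (u₁ , v₁) , (sym G (U₁ g g≢u₁) , sym H (V₁ h h≢v₁)) , f₁₁
    ... | yes refl | yes refl = ⊥-elim (two⇒nonzero f₁₁ fv≡0)
    ... | yes refl | no h≢v₁ with h ≟ v₂
    ...   | yes refl = ⊥-elim (one⇒nonzero f₁₂ fv≡0)
    ...   | no h≢v₂  = (u₂ , v₂) , (u₁~u₂ , sym H (V₂ h h≢v₂)) , f₂₂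
    dom₀ (g , h) fv≡0 | no g≢u₁ | yes refl with g ≟ u₂
    ...   | yes refl = ⊥-elim (one⇒nonzero f₂₁ fv≡0)
    ...   | no g≢u₂  = (u₂ , v₂) , (sym G (U₂ g g≢u₂) , v₁~v₂) , f₂₂
    dom₊ : ∀ v → f v ≢ L0 → NbrWith G H (_≢ L0) f v
    dom₊ v fv≢0 with assign-support ps v fv≢0
    ... | here refl = (u₂ , v₂) , (u₁~u₂ , v₁~v₂) , two⇒nonzero f₂₂
    ... | there (here refl) = (u₁ , v₁) , (sym G u₁~u₂ , sym H v₁~v₂) , two⇒nonzero f₁₁
    ... | there (there (here refl)) = (u₂ , v₁) , (u₁~u₂ , sym H v₁~v₂) , one⇒nonzero f₂₁
    ... | there (there (there (here refl))) = (u₁ , v₂) , (sym G u₁~u₂ , v₁~v₂) , one⇒nonzero f₁₂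

  order2×universal⇒6 : NoIsolated G → n ≡ 2 → NoIsolated H → HasUniversal H → Achievable G H 6
  order2×universal⇒6 noG refl noH (c , U) = f , (dom₀ , dom₊) , wt-assign ps
    where
    c' : Fin m
    c' = proj₁ (noH c)
    c~c' : Adj H c c'
    c~c' = proj₂ (noH c)
    c≢c' : c ≢ c'
    c≢c' = adj⇒≢ H c~c'
    0~1 : Adj G 0F 1F
    0~1 = order2-adj G noG 0F 1F (λ ())
    ps : List (V {2} {m} × Label)
    ps = ((0F , c) , L2) ∷ ((1F , c) , L2) ∷ ((0F , c') , L1) ∷ ((1F , c') , L1) ∷ []
    distinct : AllPairs _≢_ (map proj₁ ps)
    distinct = (≢row (λ ()) ∷ ≢col c≢c' ∷ ≢row (λ ()) ∷ [])
             ∷ (≢row (λ ()) ∷ ≢col c≢c' ∷ []) ∷ (≢row (λ ()) ∷ []) ∷ [] ∷ []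
    f : V {2} {m} → Label
    f = assign ps
    f₀c : f (0F , c) ≡ L2
    f₀c = assign-at ps distinct (here refl)
    f₁c : f (1F , c) ≡ L2
    f₁c = assign-at ps distinct (there (here refl))
    f₀c' : f (0F , c') ≡ L1
    f₀c' = assign-at ps distinct (there (there (here refl)))
    f₁c' : f (1F , c') ≡ L1
    f₁c' = assign-at ps distinct (there (there (there (here refl))))
    dom₀ : ∀ v → f v ≡ L0 → NbrWith G H (_≡ L2) f v
    dom₀ (g , h) fv≡0 with h ≟ c
    dom₀ (0F , h) fv≡0 | yes refl = ⊥-elim (two⇒nonzero f₀c fv≡0)
    dom₀ (1F , h) fv≡0 | yes refl = ⊥-elim (two⇒nonzero f₁c fv≡0)
    dom₀ (0F , h) fv≡0 | no h≢c = (1F , c) , (0~1 , sym H (U h h≢c)) , f₁c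
    dom₀ (1F , h) fv≡0 | no h≢c = (0F , c) , (sym G 0~1 , sym H (U h h≢c)) , f₀c
    dom₊ : ∀ v → f v ≢ L0 → NbrWith G H (_≢ L0) f v
    dom₊ v fv≢0 with assign-support ps v fv≢0
    ... | here refl = (1F , c') , (0~1 , c~c') , one⇒nonzero f₁c'
    ... | there (here refl) = (0F , c') , (sym G 0~1 , c~c') , one⇒nonzero f₀c'
    ... | there (there (here refl)) = (1F , c) , (0~1 , sym H c~c') , two⇒nonzero f₁c
    ... | there (there (there (here refl))) = (0F , c) , (sym G 0~1 , sym H c~c') , two⇒nonzero f₀c

  universal⇒7 : NoIsolated G → NoIsolated H → HasUniversal G → HasUniversal H → Achievable G H 7
  universal⇒7 noG noH (u , U) (v , V') = f , (dom₀ , dom₊) , wt-assign ps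
    where
    a : Fin n
    a = proj₁ (noG u)
    u~a : Adj G u a
    u~a = proj₂ (noG u)
    b : Fin m
    b = proj₁ (noH v)
    v~b : Adj H v b
    v~b = proj₂ (noH v)
    u≢a : u ≢ a
    u≢a = adj⇒≢ G u~a
    v≢b : v ≢ b
    v≢b = adj⇒≢ H v~b
    ps : List (V × Label)
    ps = ((u , v) , L2) ∷ ((u , b) , L2) ∷ ((a , v) , L2) ∷ ((a , b) , L1) ∷ []
    distinct : AllPairs _≢_ (map proj₁ ps)
    distinct = (≢col v≢b ∷ ≢row u≢a ∷ ≢row u≢a ∷ []) ∷ (≢row u≢a ∷ ≢row u≢a ∷ []) ∷ (≢col v≢b ∷ []) ∷ [] ∷ []
    f : V → Label
    f = assign ps
    f-uv : f (u , v) ≡ L2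
    f-uv = assign-at ps distinct (here refl)
    f-ub : f (u , b) ≡ L2
    f-ub = assign-at ps distinct (there (here refl))
    f-av : f (a , v) ≡ L2
    f-av = assign-at ps distinct (there (there (here refl)))
    f-ab : f (a , b) ≡ L1
    f-ab = assign-at ps distinct (there (there (there (here refl))))
    dom₀ : ∀ w → f w ≡ L0 → NbrWith G H (_≡ L2) f w
    dom₀ (g , h) fw≡0 with g ≟ u | h ≟ v
    ... | no g≢u   | no h≢v   = (u , v) , (sym G (U g g≢u) , sym H (V' h h≢v)) , f-uv
    ... | yes refl | yes refl = ⊥-elim (two⇒nonzero f-uv fw≡0)
    ... | no g≢u   | yes refl = (u , b) , (sym G (U g g≢u) , v~b) , f-ub
    ... | yes refl | no h≢v with h ≟ b
    ...   | yes refl = ⊥-elim (two⇒nonzero f-ub fw≡0)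
    ...   | no _     = (a , v) , (u~a , sym H (V' h h≢v)) , f-av
    dom₊ : ∀ w → f w ≢ L0 → NbrWith G H (_≢ L0) f w
    dom₊ w fw≢0 with assign-support ps w fw≢0
    ... | here refl = (a , b) , (u~a , v~b) , one⇒nonzero f-ab
    ... | there (here refl) = (a , v) , (u~a , sym H v~b) , two⇒nonzero f-av
    ... | there (there (here refl)) = (u , b) , (sym G u~a , v~b) , two⇒nonzero f-ub
    ... | there (there (there (here refl))) = (u , v) , (sym G u~a , sym H v~b) , two⇒nonzero f-uv

  -- Centring triangles xyz of G and x'y'z' of H: label (x,x'), (y,y'), (z,z') by 2.
  -- Any vertex is adjacent to two of x, y, z and to two of x', y', z'; these choices share an index.
  triangleCentered⇒6 : TriangleCentered G → TriangleCentered H → Achievable G H 6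
  triangleCentered⇒6 (x , y , z , x~y , y~z , x~z , centredG) (x' , y' , z' , _ , _ , _ , centredH) =
    f , dominated⇒TRDF G H f nbr , wt-assign ps
    where
    ps : List (V × Label)
    ps = ((x , x') , L2) ∷ ((y , y') , L2) ∷ ((z , z') , L2) ∷ []
    distinct : AllPairs _≢_ (map proj₁ ps)
    distinct = (≢row (adj⇒≢ G x~y) ∷ ≢row (adj⇒≢ G x~z) ∷ []) ∷ (≢row (adj⇒≢ G y~z) ∷ []) ∷ [] ∷ []
    f : V → Label
    f = assign ps
    fx : f (x , x') ≡ L2
    fx = assign-at ps distinct (here refl)
    fy : f (y , y') ≡ L2
    fy = assign-at ps distinct (there (here refl))
    fz : f (z , z') ≡ L2
    fz = assign-at ps distinct (there (there (here refl)))
    nbr : ∀ v → NbrWith G H (_≡ L2) f v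
    nbr (g , h) with centredG g | centredH h
    ... | inj₁ (g~x , _)          | inj₁ (h~x , _)          = (x , x') , (g~x , h~x) , fx
    ... | inj₁ (g~x , _)          | inj₂ (inj₁ (h~x , _))   = (x , x') , (g~x , h~x) , fx
    ... | inj₁ (_ , g~y)          | inj₂ (inj₂ (h~y , _))   = (y , y') , (g~y , h~y) , fy
    ... | inj₂ (inj₁ (g~x , _))   | inj₁ (h~x , _)          = (x , x') , (g~x , h~x) , fx
    ... | inj₂ (inj₁ (g~x , _))   | inj₂ (inj₁ (h~x , _))   = (x , x') , (g~x , h~x) , fx
    ... | inj₂ (inj₁ (_ , g~z))   | inj₂ (inj₂ (_ , h~z))   = (z , z') , (g~z , h~z) , fz
    ... | inj₂ (inj₂ (g~y , _))   | inj₁ (_ , h~y)          = (y , y') , (g~y , h~y) , fy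
    ... | inj₂ (inj₂ (_ , g~z))   | inj₂ (inj₁ (_ , h~z))   = (z , z') , (g~z , h~z) , fz
    ... | inj₂ (inj₂ (g~y , _))   | inj₂ (inj₂ (h~y , _))   = (y , y') , (g~y , h~y) , fy

  totalDomination2⇒8 : Isγt G 2 → Isγt H 2 → Achievable G H 8
  totalDomination2⇒8 ((D , D-tds , ∣D∣≡2) , _) ((D' , D'-tds , ∣D'∣≡2) , _) =
    rectangle D D' , dominated⇒TRDF G H (rectangle D D') nbr ,
    ≤-reflexive (trans (wt-rectangle D D') (cong₂ (λ a b → a * (b * 2)) ∣D∣≡2 ∣D'∣≡2))
    where
    nbr : ∀ v → NbrWith G H (_≡ L2) (rectangle D D') v
    nbr (g , h) with D-tds g | D'-tds h
    ... | g' , g~g' , g'∈D | h' , h~h' , h'∈D' = (g' , h') , (g~g' , h~h') , in-D×D'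
      where
      in-D×D' : rectangle D D' (g' , h') ≡ L2
      in-D×D' rewrite []=⇒lookup g'∈D | []=⇒lookup h'∈D' = refl

Cond6 : ∀ {n m} (G : Graph n) (H : Graph m) → Set
Cond6 {n} {m} G H =
  ((AtLeastTwoUniversal G × AtLeastTwoUniversal H × (n ≥ 3 ⊎ m ≥ 3))
  ⊎ ((IsK₂ G × m ≥ 3 × HasUniversal H) ⊎ (IsK₂ H × n ≥ 3 × HasUniversal G))
  ⊎ (TriangleCentered G × TriangleCentered H))

BothUniversal : ∀ {n m} (G : Graph n) (H : Graph m) → Set
BothUniversal G H = HasUniversal G × HasUniversal H

LowerBound : ∀ {n m} (G : Graph n) (H : Graph m) → ℕ → Set
LowerBound {n} {m} G H w =
  (n ≡ 2 × m ≡ 2 × 4 ≤ w) ⊎ (Cond6 G H × 6 ≤ w) ⊎ (BothUniversal G H × 7 ≤ w) ⊎ (8 ≤ w)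

Cond6-transpose : ∀ {n m} (G : Graph n) (H : Graph m) → Cond6 G H → Cond6 H G
Cond6-transpose G H (inj₁ (two-G , two-H , inj₁ n≥3)) = inj₁ (two-H , two-G , inj₂ n≥3)
Cond6-transpose G H (inj₁ (two-G , two-H , inj₂ m≥3)) = inj₁ (two-H , two-G , inj₁ m≥3)
Cond6-transpose G H (inj₂ (inj₁ (inj₁ K₂-G)))        = inj₂ (inj₁ (inj₂ K₂-G))
Cond6-transpose G H (inj₂ (inj₁ (inj₂ K₂-H)))        = inj₂ (inj₁ (inj₁ K₂-H))
Cond6-transpose G H (inj₂ (inj₂ (tc-G , tc-H)))      = inj₂ (inj₂ (tc-H , tc-G))

LowerBound-transpose : ∀ {n m} (G : Graph n) (H : Graph m) w → LowerBound H G w → LowerBound G H w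
LowerBound-transpose G H w (inj₁ (m≡2 , n≡2 , 4≤w))          = inj₁ (n≡2 , m≡2 , 4≤w)
LowerBound-transpose G H w (inj₂ (inj₁ (c6 , 6≤w)))          = inj₂ (inj₁ (Cond6-transpose H G c6 , 6≤w))
LowerBound-transpose G H w (inj₂ (inj₂ (inj₁ (both , 7≤w)))) = inj₂ (inj₂ (inj₁ (swap both , 7≤w)))
LowerBound-transpose G H w (inj₂ (inj₂ (inj₂ 8≤w)))          = inj₂ (inj₂ (inj₂ 8≤w))

decide≤ : ∀ {a b : ℕ} {a≤?b : True (a ≤? b)} → a ≤ b
decide≤ {a≤?b = a≤?b} = toWitness a≤?b

order2-3⇒Cond6 : ∀ {n m} (G : Graph n) (H : Graph m) → NoIsolated G → NoIsolated H →
                 (n ≡ 2 × m ≡ 3) ⊎ (n ≡ 3 × m ≡ 2) → Cond6 G H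
order2-3⇒Cond6 G H noG noH (inj₁ (n≡2 , m≡3)) =
  inj₂ (inj₁ (inj₁ (order2⇒K₂ G noG n≡2 , ≤-reflexive (≡-sym m≡3) , order3⇒hasUniversal H noH m≡3)))
order2-3⇒Cond6 G H noG noH (inj₂ (n≡3 , m≡2)) =
  inj₂ (inj₁ (inj₂ (order2⇒K₂ H noH m≡2 , ≤-reflexive (≡-sym n≡3) , order3⇒hasUniversal G noG n≡3)))

-- The inequalities between orders used when at most one vertex is labelled 2; they hold
-- away from the orders (2,2), (2,3), (3,2).
Large : ℕ → ℕ → Set
Large n m = 7 ≤ m + n + 1 × 8 ≤ m + m + n × 8 ≤ n + n + m × 8 ≤ n * (m * 1)

Large-mono : ∀ {a b n m} → a ≤ n → b ≤ m → Large a b → Large n m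
Large-mono a≤n b≤m (p₁ , p₂ , p₃ , p₄) =
  ≤-trans p₁ (+-monoˡ-≤ 1 (+-mono-≤ b≤m a≤n)) ,
  ≤-trans p₂ (+-mono-≤ (+-mono-≤ b≤m b≤m) a≤n) ,
  ≤-trans p₃ (+-mono-≤ (+-mono-≤ a≤n a≤n) b≤m) ,
  ≤-trans p₄ (*-mono-≤ a≤n (*-monoˡ-≤ 1 b≤m))

large : ∀ {a b} {p₁ : True (7 ≤? b + a + 1)} {p₂ : True (8 ≤? b + b + a)} {p₃ : True (8 ≤? a + a + b)}
          {p₄ : True (8 ≤? a * (b * 1))} → Large a b
large {p₁ = p₁} {p₂} {p₃} {p₄} = toWitness p₁ , toWitness p₂ , toWitness p₃ , toWitness p₄

order-cases : ∀ {n m} → 2 ≤ n → 2 ≤ m →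
              (n ≡ 2 × m ≡ 2) ⊎ (n ≡ 2 × m ≡ 3) ⊎ (n ≡ 3 × m ≡ 2) ⊎ Large n m
order-cases {n} {m} 2≤n 2≤m with 2≤⇒2or3or4≤ 2≤n | 2≤⇒2or3or4≤ 2≤m
... | inj₁ refl        | inj₁ refl        = inj₁ (refl , refl)
... | inj₁ refl        | inj₂ (inj₁ refl) = inj₂ (inj₁ (refl , refl))
... | inj₂ (inj₁ refl) | inj₁ refl        = inj₂ (inj₂ (inj₁ (refl , refl)))
... | inj₁ refl        | inj₂ (inj₂ 4≤m)  = inj₂ (inj₂ (inj₂ (Large-mono ≤-refl 4≤m (large {2} {4}))))
... | inj₂ (inj₁ refl) | inj₂ (inj₁ refl) = inj₂ (inj₂ (inj₂ (large {3} {3})))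
... | inj₂ (inj₁ refl) | inj₂ (inj₂ 4≤m)  = inj₂ (inj₂ (inj₂ (Large-mono ≤-refl 4≤m (large {3} {4}))))
... | inj₂ (inj₂ 4≤n)  | _                = inj₂ (inj₂ (inj₂ (Large-mono 4≤n 2≤m (large {4} {2}))))

module Labelled {n m} (G : Graph n) (H : Graph m) (f : V {n} {m} → Label) (tr : TRDF× G H f) where

  F : V {n} {m} → ℕ
  F v = val (f v)

  W : ℕ
  W = wt f

  dom₀ : ∀ v → f v ≡ L0 → NbrWith G H (_≡ L2) f v
  dom₀ = proj₁ tr

  dom₊ : ∀ v → f v ≢ L0 → NbrWith G H (_≢ L0) f v
  dom₊ = proj₂ tr

  one≢two : ∀ {v w} → f v ≡ L1 → f w ≡ L2 → v ≢ w
  one≢two fv≡1 fw≡2 refl with trans (≡-sym fv≡1) fw≡2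
  ... | ()

  nonzero⇒1≤ : ∀ {v} → f v ≢ L0 → 1 ≤ F v
  nonzero⇒1≤ {v} fv≢0 with f v
  ... | L0 = ⊥-elim (fv≢0 refl)
  ... | L1 = s≤s z≤n
  ... | L2 = s≤s z≤n

  two⇒2≤ : ∀ {v} → f v ≡ L2 → 2 ≤ F v
  two⇒2≤ fv≡2 rewrite fv≡2 = ≤-refl

  in-row : ∀ {g a h k} → eqFin g a ≡ true → k ≤ F (a , h) → k ≤ F (g , h)
  in-row {h = h} {k} g≡a = subst (λ x → k ≤ F (x , h)) (≡-sym (eqFin-true g≡a))

  in-col : ∀ {g h b k} → eqFin h b ≡ true → k ≤ F (g , b) → k ≤ F (g , h)
  in-col {g} {k = k} h≡b = subst (λ y → k ≤ F (g , y)) (≡-sym (eqFin-true h≡b))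

  W≥points : (ps : List (V {n} {m} × ℕ)) → AllPairs _≢_ (map proj₁ ps) →
             All (λ (p , k) → k ≤ F p) ps → sum (map proj₂ ps) ≤ W
  W≥points = Σ²-points F

  adj≢G : ∀ {a b} → Adj G a b → a ≢ b
  adj≢G = adj⇒≢ G

  adj≢H : ∀ {a b} → Adj H a b → a ≢ b
  adj≢H = adj⇒≢ H

-- With no vertex labelled 2 no vertex can be labelled 0, so the weight is at least n m.
noTwo⇒LowerBound : ∀ {n m} (G : Graph n) (H : Graph m) → NoIsolated G → NoIsolated H →
                   ∀ f → TRDF× G H f → 2 ≤ n → 2 ≤ m → (∀ v → f v ≢ L2) → LowerBound G H (wt f)
noTwo⇒LowerBound {n} {m} G H noG noH f tr 2≤n 2≤m noTwo = byOrder (order-cases 2≤n 2≤m)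
  where
  open Labelled G H f tr
  W≥nm : n * (m * 1) ≤ W
  W≥nm = subst (_≤ W) (Σ²-const {n} {m} 1)
           (Σ²-mono (λ v → nonzero⇒1≤ (λ fv≡0 → noTwo _ (proj₂ (proj₂ (dom₀ v fv≡0))))))
  byOrder : (n ≡ 2 × m ≡ 2) ⊎ (n ≡ 2 × m ≡ 3) ⊎ (n ≡ 3 × m ≡ 2) ⊎ Large n m → LowerBound G H (wt f)
  byOrder (inj₁ (refl , refl))               = inj₁ (refl , refl , W≥nm)
  byOrder (inj₂ (inj₁ orders@(refl , refl))) = inj₂ (inj₁ (order2-3⇒Cond6 G H noG noH (inj₁ orders) , W≥nm))
  byOrder (inj₂ (inj₂ (inj₁ orders@(refl , refl)))) = inj₂ (inj₁ (order2-3⇒Cond6 G H noG noH (inj₂ orders) , W≥nm))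
  byOrder (inj₂ (inj₂ (inj₂ (_ , _ , _ , 8≤nm)))) = inj₂ (inj₂ (inj₂ (≤-trans 8≤nm W≥nm)))

module OneTwo {n m} (G : Graph n) (H : Graph m) (f : V {n} {m} → Label) (tr : TRDF× G H f)
              (a : Fin n) (b : Fin m) (fx≡2 : f (a , b) ≡ L2) (only : ∀ v → f v ≡ L2 → v ≡ (a , b)) where
  open Labelled G H f tr

  -- Every vertex labelled 0 is adjacent to x, hence no vertex of row a or column b is labelled 0.
  adjacent-to-x : ∀ v → f v ≡ L0 → Adj× G H v (a , b)
  adjacent-to-x v fv≡0 with dom₀ v fv≡0
  ... | w , v~w , fw≡2 rewrite only w fw≡2 = v~w

  row-a-nonzero : ∀ h → f (a , h) ≢ L0
  row-a-nonzero h fah≡0 = irrefl G (proj₁ (adjacent-to-x (a , h) fah≡0))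

  col-b-nonzero : ∀ g → f (g , b) ≢ L0
  col-b-nonzero g fgb≡0 = irrefl H (proj₂ (adjacent-to-x (g , b) fgb≡0))

  z : V
  z = proj₁ (dom₊ (a , b) (two⇒nonzero fx≡2))

  x~z : Adj× G H (a , b) z
  x~z = proj₁ (proj₂ (dom₊ (a , b) (two⇒nonzero fx≡2)))

  fz≢0 : f z ≢ L0
  fz≢0 = proj₂ (proj₂ (dom₊ (a , b) (two⇒nonzero fx≡2)))

  z-off-a : eqFin (proj₁ z) a ≡ false
  z-off-a = eqFin-≢ (λ e → adj≢G (proj₁ x~z) (≡-sym e))

  z-off-b : eqFin (proj₂ z) b ≡ false
  z-off-b = eqFin-≢ (λ e → adj≢H (proj₂ x~z) (≡-sym e))

  -- Row a and column b are nonzero, x counts 2, and z adds 1.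
  W≥m+n+1 : m + n + 1 ≤ W
  W≥m+n+1 = subst (_≤ W) (cong (_+ 1) (trans (Σ²-+ {n} {m} (row a) (col b)) (cong₂ _+_ (Σ²-row {m = m} a) (Σ²-col {n} b))))
    (Σ²-lowerBound ℓ F ℓ≤F ((z , 1) ∷ []) ([] ∷ []) (z-bonus ∷ []))
    where
    ℓ : V → ℕ
    ℓ v = row a v + col b v
    ℓ≤F : ∀ v → ℓ v ≤ F v
    ℓ≤F (g , h) with eqFin g a in g≡a | eqFin h b in h≡b
    ... | true  | true  = in-row g≡a (in-col h≡b (two⇒2≤ fx≡2))
    ... | true  | false = in-row g≡a (nonzero⇒1≤ (row-a-nonzero h))
    ... | false | true  = in-col h≡b (nonzero⇒1≤ (col-b-nonzero g))
    ... | false | false = z≤n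
    z-bonus : 1 + ℓ z ≤ F z
    z-bonus rewrite z-off-a | z-off-b = nonzero⇒1≤ fz≢0

  -- If g₀ is not adjacent to a, row g₀ is nonzero too. The cell (g₀ , b) is then counted twice,
  -- once in row g₀ and once in column b, which the extra unit at (g₀ , b) pays for.
  W≥m+m+n : (g₀ : Fin n) → g₀ ≢ a → ¬ Adj G a g₀ → m + m + n ≤ W
  W≥m+m+n g₀ g₀≢a a≁g₀ = +-cancelʳ-≤ 1 _ _ (subst₂ _≤_ Σℓ+1 ΣF'
      (Σ²-lowerBound ℓ F' ℓ≤F' ((z , 1) ∷ []) ([] ∷ []) (z-bonus ∷ [])))
    where
    row-g₀-nonzero : ∀ h → f (g₀ , h) ≢ L0
    row-g₀-nonzero h fg₀h≡0 = a≁g₀ (sym G (proj₁ (adjacent-to-x (g₀ , h) fg₀h≡0)))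
    ℓ F' : V → ℕ
    ℓ  v = row a v + row g₀ v + col b v
    F' v = F v + point (g₀ , b) 1 v
    Σℓ+1 : Σ² ℓ + (1 + 0) ≡ m + m + n + 1
    Σℓ+1 = cong (_+ 1) (trans (Σ²-+ {n} {m} _ (col b))
             (cong₂ _+_ (trans (Σ²-+ {n} {m} (row a) (row g₀)) (cong₂ _+_ (Σ²-row {m = m} a) (Σ²-row {m = m} g₀))) (Σ²-col {n} b)))
    ΣF' : Σ² F' ≡ W + 1
    ΣF' = trans (Σ²-+ F (point (g₀ , b) 1)) (cong (W +_) (Σ²-point (g₀ , b) 1))
    ℓ≤F' : ∀ v → ℓ v ≤ F' v
    ℓ≤F' (g , h) with eqFin g a in g≡a | eqFin g g₀ in g≡g₀ | eqFin h b in h≡b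
    ... | true  | true  | _     = ⊥-elim (g₀≢a (trans (≡-sym (eqFin-true {a = g} g≡g₀)) (eqFin-true g≡a)))
    ... | true  | false | true  = ≤-trans (in-row g≡a (in-col h≡b (two⇒2≤ fx≡2))) (m≤m+n _ _)
    ... | true  | false | false = ≤-trans (in-row g≡a (nonzero⇒1≤ (row-a-nonzero h))) (m≤m+n _ _)
    ... | false | true  | true  = subst (λ y → 2 ≤ F (g , y) + 1) (≡-sym (eqFin-true h≡b))
                                    (+-monoˡ-≤ 1 (in-row g≡g₀ (nonzero⇒1≤ (row-g₀-nonzero b))))
    ... | false | true  | false = ≤-trans (in-row g≡g₀ (nonzero⇒1≤ (row-g₀-nonzero h))) (m≤m+n _ _)
    ... | false | false | true  = ≤-trans (in-col h≡b (nonzero⇒1≤ (col-b-nonzero g))) (m≤m+n _ _)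
    ... | false | false | false = z≤n
    z-bonus : 1 + ℓ z ≤ F' z
    z-bonus rewrite z-off-a | z-off-b | eqFin-≢ {a = proj₁ z} {b = g₀} (λ e → a≁g₀ (subst (Adj G a) e (proj₁ x~z)))
      = ≤-trans (nonzero⇒1≤ fz≢0) (m≤m+n _ _)

-- One vertex labelled 2: the bound m + n + 1 settles the small orders and gives 7 when a and b
-- are universal; a non-neighbour of a (or of b, by transposition) gives 8.
oneTwo⇒LowerBound : ∀ {n m} (G : Graph n) (H : Graph m) → NoIsolated G → NoIsolated H →
                    ∀ f → TRDF× G H f → 2 ≤ n → 2 ≤ m → ∀ a b → f (a , b) ≡ L2 →
                    (∀ v → f v ≡ L2 → v ≡ (a , b)) → LowerBound G H (wt f)
oneTwo⇒LowerBound {n} {m} G H noG noH f tr 2≤n 2≤m a b fx≡2 only = byOrder (order-cases 2≤n 2≤m)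
  where
  open OneTwo G H f tr a b fx≡2 only
  -- The same situation in H × G, to handle a non-universal b.
  module Transposed = OneTwo H G (f ∘ swap) (transpose-TRDF G H f tr) b a fx≡2 (λ w e → cong swap (only (swap w) e))
  byOrder : (n ≡ 2 × m ≡ 2) ⊎ (n ≡ 2 × m ≡ 3) ⊎ (n ≡ 3 × m ≡ 2) ⊎ Large n m → LowerBound G H (wt f)
  byOrder (inj₁ (refl , refl))                      = inj₁ (refl , refl , ≤-trans decide≤ W≥m+n+1)
  byOrder (inj₂ (inj₁ orders@(refl , refl)))        = inj₂ (inj₁ (order2-3⇒Cond6 G H noG noH (inj₁ orders) , W≥m+n+1))
  byOrder (inj₂ (inj₂ (inj₁ orders@(refl , refl)))) = inj₂ (inj₁ (order2-3⇒Cond6 G H noG noH (inj₂ orders) , W≥m+n+1))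
  byOrder (inj₂ (inj₂ (inj₂ (7≤m+n+1 , 8≤m+m+n , 8≤n+n+m , _)))) with universal? G a | universal? H b
  ... | yes a-univ | yes b-univ = inj₂ (inj₂ (inj₁ (((a , a-univ) , (b , b-univ)) , ≤-trans 7≤m+n+1 W≥m+n+1)))
  ... | no ¬a-univ | _ =
    let (g₀ , g₀≢a , a≁g₀) = nonNeighbour G ¬a-univ in inj₂ (inj₂ (inj₂ (≤-trans 8≤m+m+n (W≥m+m+n g₀ g₀≢a a≁g₀))))
  ... | yes _      | no ¬b-univ =
    let (h₀ , h₀≢b , b≁h₀) = nonNeighbour H ¬b-univ
    in inj₂ (inj₂ (inj₂ (≤-trans 8≤n+n+m (subst (n + n + m ≤_) (transpose-wt G H f) (Transposed.W≥m+m+n h₀ h₀≢b b≁h₀)))))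

module TwoTwos {n m} (G : Graph n) (H : Graph m) (f : V {n} {m} → Label) (tr : TRDF× G H f)
               (a₁ a₂ : Fin n) (b₁ b₂ : Fin m) (f₁ : f (a₁ , b₁) ≡ L2) (f₂ : f (a₂ , b₂) ≡ L2)
               (x₁≢x₂ : (a₁ , b₁) ≢ (a₂ , b₂)) (only : ∀ v → f v ≡ L2 → v ≡ (a₁ , b₁) ⊎ v ≡ (a₂ , b₂)) where
  open Labelled G H f tr

  x₁ x₂ : V
  x₁ = a₁ , b₁
  x₂ = a₂ , b₂

  undominated⇒nonzero : ∀ v → ¬ Adj× G H v x₁ → ¬ Adj× G H v x₂ → f v ≢ L0
  undominated⇒nonzero v v≁x₁ v≁x₂ fv≡0 with dom₀ v fv≡0
  ... | w , v~w , fw≡2 with only w fw≡2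
  ...   | inj₁ refl = v≁x₁ v~w
  ...   | inj₂ refl = v≁x₂ v~w

  y₁ y₂ : V
  y₁ = proj₁ (dom₊ x₁ (two⇒nonzero f₁))
  y₂ = proj₁ (dom₊ x₂ (two⇒nonzero f₂))

  x₁~y₁ : Adj× G H x₁ y₁
  x₁~y₁ = proj₁ (proj₂ (dom₊ x₁ (two⇒nonzero f₁)))

  x₂~y₂ : Adj× G H x₂ y₂
  x₂~y₂ = proj₁ (proj₂ (dom₊ x₂ (two⇒nonzero f₂)))

  fy₁≢0 : f y₁ ≢ L0
  fy₁≢0 = proj₂ (proj₂ (dom₊ x₁ (two⇒nonzero f₁)))

  fy₂≢0 : f y₂ ≢ L0
  fy₂≢0 = proj₂ (proj₂ (dom₊ x₂ (two⇒nonzero f₂)))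

  -- When x₁, x₂ differ in both coordinates, the other corners c₁ = (a₁ , b₂), c₂ = (a₂ , b₁)
  -- of their rectangle share a coordinate with each of them, so they are nonzero.
  module Rectangle (a₁≢a₂ : a₁ ≢ a₂) (b₁≢b₂ : b₁ ≢ b₂) where
    c₁ c₂ : V
    c₁ = a₁ , b₂
    c₂ = a₂ , b₁

    fc₁≢0 : f c₁ ≢ L0
    fc₁≢0 = undominated⇒nonzero c₁ (λ c₁~x₁ → irrefl G (proj₁ c₁~x₁)) (λ c₁~x₂ → irrefl H (proj₂ c₁~x₂))

    fc₂≢0 : f c₂ ≢ L0
    fc₂≢0 = undominated⇒nonzero c₂ (λ c₂~x₁ → irrefl H (proj₂ c₂~x₁)) (λ c₂~x₂ → irrefl G (proj₁ c₂~x₂))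

    Extra : V → Set
    Extra e = f e ≢ L0 × x₁ ≢ e × x₂ ≢ e × c₁ ≢ e × c₂ ≢ e

    W≥6 : 6 ≤ W
    W≥6 = W≥points ((x₁ , 2) ∷ (x₂ , 2) ∷ (c₁ , 1) ∷ (c₂ , 1) ∷ [])
      ((x₁≢x₂ ∷ ≢col b₁≢b₂ ∷ ≢row a₁≢a₂ ∷ []) ∷ (≢row (≢-sym a₁≢a₂) ∷ ≢col (≢-sym b₁≢b₂) ∷ []) ∷
       (≢row a₁≢a₂ ∷ []) ∷ [] ∷ [])
      (two⇒2≤ f₁ ∷ two⇒2≤ f₂ ∷ nonzero⇒1≤ fc₁≢0 ∷ nonzero⇒1≤ fc₂≢0 ∷ [])

    W≥7 : ∀ {e} → Extra e → 7 ≤ W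
    W≥7 {e} (fe≢0 , x₁≢e , x₂≢e , c₁≢e , c₂≢e) =
      W≥points ((x₁ , 2) ∷ (x₂ , 2) ∷ (c₁ , 1) ∷ (c₂ , 1) ∷ (e , 1) ∷ [])
      ((x₁≢x₂ ∷ ≢col b₁≢b₂ ∷ ≢row a₁≢a₂ ∷ x₁≢e ∷ []) ∷
       (≢row (≢-sym a₁≢a₂) ∷ ≢col (≢-sym b₁≢b₂) ∷ x₂≢e ∷ []) ∷
       (≢row a₁≢a₂ ∷ c₁≢e ∷ []) ∷ (c₂≢e ∷ []) ∷ [] ∷ [])
      (two⇒2≤ f₁ ∷ two⇒2≤ f₂ ∷ nonzero⇒1≤ fc₁≢0 ∷ nonzero⇒1≤ fc₂≢0 ∷ nonzero⇒1≤ fe≢0 ∷ [])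

    W≥8 : ∀ {e e'} → Extra e → Extra e' → e ≢ e' → 8 ≤ W
    W≥8 {e} {e'} (fe≢0 , x₁≢e , x₂≢e , c₁≢e , c₂≢e) (fe'≢0 , x₁≢e' , x₂≢e' , c₁≢e' , c₂≢e') e≢e' =
      W≥points ((x₁ , 2) ∷ (x₂ , 2) ∷ (c₁ , 1) ∷ (c₂ , 1) ∷ (e , 1) ∷ (e' , 1) ∷ [])
      ((x₁≢x₂ ∷ ≢col b₁≢b₂ ∷ ≢row a₁≢a₂ ∷ x₁≢e ∷ x₁≢e' ∷ []) ∷
       (≢row (≢-sym a₁≢a₂) ∷ ≢col (≢-sym b₁≢b₂) ∷ x₂≢e ∷ x₂≢e' ∷ []) ∷
       (≢row a₁≢a₂ ∷ c₁≢e ∷ c₁≢e' ∷ []) ∷ (c₂≢e ∷ c₂≢e' ∷ []) ∷ (e≢e' ∷ []) ∷ [] ∷ [])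
      (two⇒2≤ f₁ ∷ two⇒2≤ f₂ ∷ nonzero⇒1≤ fc₁≢0 ∷ nonzero⇒1≤ fc₂≢0 ∷
       nonzero⇒1≤ fe≢0 ∷ nonzero⇒1≤ fe'≢0 ∷ [])

  -- x₁ and x₂ adjacent: the bound is 6, raised by one for each of a₁, a₂, b₁, b₂ that
  -- is not universal (a non-neighbour yields an extra nonzero vertex), up to 8.
  module Adjacent (a₁~a₂ : Adj G a₁ a₂) (b₁~b₂ : Adj H b₁ b₂) where
    a₁≢a₂ : a₁ ≢ a₂
    a₁≢a₂ = adj≢G a₁~a₂
    b₁≢b₂ : b₁ ≢ b₂
    b₁≢b₂ = adj≢H b₁~b₂
    open Rectangle a₁≢a₂ b₁≢b₂

    extra-a₁ : ∀ g → g ≢ a₁ → ¬ Adj G a₁ g → Extra (g , b₂)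
    extra-a₁ g g≢a₁ a₁≁g =
      undominated⇒nonzero (g , b₂) (λ p~x₁ → a₁≁g (sym G (proj₁ p~x₁))) (λ p~x₂ → irrefl H (proj₂ p~x₂)) ,
      ≢row (≢-sym g≢a₁) , ≢row (≢-sym g≢a₂) , ≢row (≢-sym g≢a₁) , ≢row (≢-sym g≢a₂)
      where
      g≢a₂ : g ≢ a₂
      g≢a₂ refl = a₁≁g a₁~a₂

    extra-a₂ : ∀ g → g ≢ a₂ → ¬ Adj G a₂ g → Extra (g , b₁)
    extra-a₂ g g≢a₂ a₂≁g =
      undominated⇒nonzero (g , b₁) (λ p~x₁ → irrefl H (proj₂ p~x₁)) (λ p~x₂ → a₂≁g (sym G (proj₁ p~x₂))) ,
      ≢row (≢-sym g≢a₁) , ≢col (≢-sym b₁≢b₂) , ≢col (≢-sym b₁≢b₂) , ≢row (≢-sym g≢a₂)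
      where
      g≢a₁ : g ≢ a₁
      g≢a₁ refl = a₂≁g (sym G a₁~a₂)

    extra-b₁ : ∀ h → h ≢ b₁ → ¬ Adj H b₁ h → Extra (a₂ , h)
    extra-b₁ h h≢b₁ b₁≁h =
      undominated⇒nonzero (a₂ , h) (λ p~x₁ → b₁≁h (sym H (proj₂ p~x₁))) (λ p~x₂ → irrefl G (proj₁ p~x₂)) ,
      ≢row a₁≢a₂ , ≢col (≢-sym h≢b₂) , ≢row a₁≢a₂ , ≢col (≢-sym h≢b₁)
      where
      h≢b₂ : h ≢ b₂
      h≢b₂ refl = b₁≁h b₁~b₂

    extra-b₂ : ∀ h → h ≢ b₂ → ¬ Adj H b₂ h → Extra (a₁ , h)
    extra-b₂ h h≢b₂ b₂≁h =
      undominated⇒nonzero (a₁ , h) (λ p~x₁ → irrefl G (proj₁ p~x₁)) (λ p~x₂ → b₂≁h (sym H (proj₂ p~x₂))) ,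
      ≢col (≢-sym h≢b₁) , ≢row (≢-sym a₁≢a₂) , ≢col (≢-sym h≢b₂) , ≢row (≢-sym a₁≢a₂)
      where
      h≢b₁ : h ≢ b₁
      h≢b₁ refl = b₂≁h (sym H b₁~b₂)

    seven : BothUniversal G H → ∀ {e} → Extra e → LowerBound G H W
    seven both extra = inj₂ (inj₂ (inj₁ (both , W≥7 extra)))

    allUniversal : AtLeastTwoUniversal G → AtLeastTwoUniversal H → LowerBound G H W
    allUniversal twoG twoH with 2≤⇒2or3≤ (two-distinct⇒2≤ a₁≢a₂) | 2≤⇒2or3≤ (two-distinct⇒2≤ b₁≢b₂)
    ... | inj₁ n≡2 | inj₁ m≡2 = inj₁ (n≡2 , m≡2 , ≤-trans decide≤ W≥6)
    ... | inj₂ 3≤n | _        = inj₂ (inj₁ (inj₁ (twoG , twoH , inj₁ 3≤n) , W≥6))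
    ... | inj₁ _   | inj₂ 3≤m = inj₂ (inj₁ (inj₁ (twoG , twoH , inj₂ 3≤m) , W≥6))

    result : LowerBound G H W
    result with universal? G a₁ | universal? G a₂ | universal? H b₁ | universal? H b₂
    ... | yes u₁ | yes u₂ | yes v₁ | yes v₂ = allUniversal (a₁ , a₂ , a₁≢a₂ , u₁ , u₂) (b₁ , b₂ , b₁≢b₂ , v₁ , v₂)
    ... | no ¬u₁ | no ¬u₂ | _ | _ =
      let (g , g≢a₁ , a₁≁g) = nonNeighbour G ¬u₁ ; (g' , g'≢a₂ , a₂≁g') = nonNeighbour G ¬u₂
      in inj₂ (inj₂ (inj₂ (W≥8 (extra-a₁ g g≢a₁ a₁≁g) (extra-a₂ g' g'≢a₂ a₂≁g') (≢col (≢-sym b₁≢b₂)))))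
    ... | _ | _ | no ¬v₁ | no ¬v₂ =
      let (h , h≢b₁ , b₁≁h) = nonNeighbour H ¬v₁ ; (h' , h'≢b₂ , b₂≁h') = nonNeighbour H ¬v₂
      in inj₂ (inj₂ (inj₂ (W≥8 (extra-b₁ h h≢b₁ b₁≁h) (extra-b₂ h' h'≢b₂ b₂≁h') (≢row (≢-sym a₁≢a₂)))))
    ... | no ¬u₁ | yes u₂ | yes v₁ | _ =
      let (g , g≢a₁ , a₁≁g) = nonNeighbour G ¬u₁ in seven ((a₂ , u₂) , (b₁ , v₁)) (extra-a₁ g g≢a₁ a₁≁g)
    ... | no ¬u₁ | yes u₂ | no _ | yes v₂ =
      let (g , g≢a₁ , a₁≁g) = nonNeighbour G ¬u₁ in seven ((a₂ , u₂) , (b₂ , v₂)) (extra-a₁ g g≢a₁ a₁≁g)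
    ... | yes u₁ | no ¬u₂ | yes v₁ | _ =
      let (g , g≢a₂ , a₂≁g) = nonNeighbour G ¬u₂ in seven ((a₁ , u₁) , (b₁ , v₁)) (extra-a₂ g g≢a₂ a₂≁g)
    ... | yes u₁ | no ¬u₂ | no _ | yes v₂ =
      let (g , g≢a₂ , a₂≁g) = nonNeighbour G ¬u₂ in seven ((a₁ , u₁) , (b₂ , v₂)) (extra-a₂ g g≢a₂ a₂≁g)
    ... | yes u₁ | yes _ | no ¬v₁ | yes v₂ =
      let (h , h≢b₁ , b₁≁h) = nonNeighbour H ¬v₁ in seven ((a₁ , u₁) , (b₂ , v₂)) (extra-b₁ h h≢b₁ b₁≁h)
    ... | yes u₁ | yes _ | yes v₁ | no ¬v₂ =
      let (h , h≢b₂ , b₂≁h) = nonNeighbour H ¬v₂ in seven ((a₁ , u₁) , (b₁ , v₁)) (extra-b₂ h h≢b₂ b₂≁h)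

  -- x₁ and x₂ non-adjacent, in different rows and columns: always at least 8. Besides the
  -- corners there are the neighbours y₁, y₂; if they coincide, one more nonzero vertex
  -- is found next to the corners.
  module Apart (a₁≢a₂ : a₁ ≢ a₂) (b₁≢b₂ : b₁ ≢ b₂) (x₁≁x₂ : ¬ Adj× G H x₁ x₂) where
    open Rectangle a₁≢a₂ b₁≢b₂

    extra-y₁ : Extra y₁
    extra-y₁ = fy₁≢0 , ≢row (adj≢G (proj₁ x₁~y₁)) , (λ x₂≡y₁ → x₁≁x₂ (subst (Adj× G H x₁) (≡-sym x₂≡y₁) x₁~y₁)) ,
               ≢row (adj≢G (proj₁ x₁~y₁)) , ≢col (adj≢H (proj₂ x₁~y₁))

    extra-y₂ : Extra y₂
    extra-y₂ = fy₂≢0 ,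
               (λ x₁≡y₂ → x₁≁x₂ (subst (λ v → Adj× G H v x₂) (≡-sym x₁≡y₂) (sym G (proj₁ x₂~y₂) , sym H (proj₂ x₂~y₂)))) ,
               ≢row (adj≢G (proj₁ x₂~y₂)) , ≢col (adj≢H (proj₂ x₂~y₂)) , ≢row (adj≢G (proj₁ x₂~y₂))

    result : 8 ≤ W
    result with y₁ ≟V y₂
    ... | no y₁≢y₂ = W≥8 extra-y₁ extra-y₂ y₁≢y₂
    ... | yes y₁≡y₂ = W≥8 extra-y₁ (extra-d (dec G a₁ a₂)) (y₁≢d (dec G a₁ a₂))
      where
      x₂~y₁ : Adj× G H x₂ y₁
      x₂~y₁ = subst (Adj× G H x₂) (≡-sym y₁≡y₂) x₂~y₂
      -- If a₁ ≁ a₂ take d = (a₁ , y₁₂); otherwise b₁ ≁ b₂ and take d = (y₁₁ , b₁).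
      d : Dec (Adj G a₁ a₂) → V
      d (no _)  = a₁ , proj₂ y₁
      d (yes _) = proj₁ y₁ , b₁
      extra-d : ∀ a₁~a₂? → Extra (d a₁~a₂?)
      extra-d (no a₁≁a₂) =
        undominated⇒nonzero (d (no a₁≁a₂)) (λ d~x₁ → irrefl G (proj₁ d~x₁)) (λ d~x₂ → a₁≁a₂ (proj₁ d~x₂)) ,
        ≢col (adj≢H (proj₂ x₁~y₁)) , ≢row (≢-sym a₁≢a₂) , ≢col (adj≢H (proj₂ x₂~y₁)) , ≢row (≢-sym a₁≢a₂)
      extra-d (yes a₁~a₂) =
        undominated⇒nonzero (d (yes a₁~a₂)) (λ d~x₁ → irrefl H (proj₂ d~x₁)) (λ d~x₂ → x₁≁x₂ (a₁~a₂ , proj₂ d~x₂)) ,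
        ≢row (adj≢G (proj₁ x₁~y₁)) , ≢col (≢-sym b₁≢b₂) , ≢row (adj≢G (proj₁ x₁~y₁)) , ≢row (adj≢G (proj₁ x₂~y₁))
      y₁≢d : ∀ a₁~a₂? → y₁ ≢ d a₁~a₂?
      y₁≢d (no _)  = ≢row (≢-sym (adj≢G (proj₁ x₁~y₁)))
      y₁≢d (yes _) = ≢col (≢-sym (adj≢H (proj₂ x₁~y₁)))

-- Both vertices labelled 2 lie in one row: x₁ = (a , b₁), x₂ = (a , b₂). Then the whole
-- row a is nonzero (no vertex of it is adjacent to x₁ or x₂).
module SameRow {n m} (G : Graph n) (H : Graph m) (noG : NoIsolated G) (noH : NoIsolated H)
               (f : V {n} {m} → Label) (tr : TRDF× G H f)
               (a : Fin n) (b₁ b₂ : Fin m) (f₁ : f (a , b₁) ≡ L2) (f₂ : f (a , b₂) ≡ L2) (b₁≢b₂ : b₁ ≢ b₂)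
               (only : ∀ v → f v ≡ L2 → v ≡ (a , b₁) ⊎ v ≡ (a , b₂)) where
  open Labelled G H f tr
  open TwoTwos G H f tr a a b₁ b₂ f₁ f₂ (≢col b₁≢b₂) only

  row-a-nonzero : ∀ h → f (a , h) ≢ L0
  row-a-nonzero h = undominated⇒nonzero (a , h) (λ v~x₁ → irrefl G (proj₁ v~x₁)) (λ v~x₂ → irrefl G (proj₁ v~x₂))

  row-a≤F : ∀ v → row a v ≤ F v
  row-a≤F (g , h) with eqFin g a in g≡a
  ... | true  = in-row g≡a (nonzero⇒1≤ (row-a-nonzero h))
  ... | false = z≤n

  y' : V
  y' = proj₁ (dom₊ (a , proj₂ y₁) (row-a-nonzero _))

  z~y' : Adj× G H (a , proj₂ y₁) y'
  z~y' = proj₁ (proj₂ (dom₊ (a , proj₂ y₁) (row-a-nonzero _)))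

  fy'≢0 : f y' ≢ L0
  fy'≢0 = proj₂ (proj₂ (dom₊ (a , proj₂ y₁) (row-a-nonzero _)))

  -- Row a, one extra unit at each of x₁, x₂, and y₁, y' off the row.
  W≥m+4 : m + 4 ≤ W
  W≥m+4 = subst (_≤ W) (cong (_+ 4) (Σ²-row {m = m} a)) (Σ²-lowerBound (row a) F row-a≤F
      ((x₁ , 1) ∷ (x₂ , 1) ∷ (y₁ , 1) ∷ (y' , 1) ∷ [])
      ((≢col b₁≢b₂ ∷ ≢row (adj≢G (proj₁ x₁~y₁)) ∷ ≢row (adj≢G (proj₁ z~y')) ∷ []) ∷
       (≢row (adj≢G (proj₁ x₁~y₁)) ∷ ≢row (adj≢G (proj₁ z~y')) ∷ []) ∷
       (≢col (adj≢H (proj₂ z~y')) ∷ []) ∷ [] ∷ [])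
      (x-bonus f₁ ∷ x-bonus f₂ ∷ off-row fy₁≢0 (adj≢G (proj₁ x₁~y₁)) ∷ off-row fy'≢0 (adj≢G (proj₁ z~y')) ∷ []))
    where
    x-bonus : ∀ {b} → f (a , b) ≡ L2 → 1 + row a (a , b) ≤ F (a , b)
    x-bonus fx≡2 rewrite eqFin-refl a = two⇒2≤ fx≡2
    off-row : ∀ {v} → f v ≢ L0 → a ≢ proj₁ v → 1 + row a v ≤ F v
    off-row fv≢0 a≢g rewrite eqFin-≢ (≢-sym a≢g) = nonzero⇒1≤ fv≢0

  -- If g₀ is not adjacent to a, row g₀ is nonzero as well, which forces weight 8.
  W≥8 : (g₀ : Fin n) → g₀ ≢ a → ¬ Adj G a g₀ → 8 ≤ W
  W≥8 g₀ g₀≢a a≁g₀ = byCoincidence (y₁ ≟V y₂)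
    where
    row-g₀-nonzero : ∀ h → f (g₀ , h) ≢ L0
    row-g₀-nonzero h =
      undominated⇒nonzero (g₀ , h) (λ v~x₁ → a≁g₀ (sym G (proj₁ v~x₁))) (λ v~x₂ → a≁g₀ (sym G (proj₁ v~x₂)))
    ℓ : V → ℕ
    ℓ v = row a v + row g₀ v
    Σℓ : Σ² ℓ ≡ m + m
    Σℓ = trans (Σ²-+ {n} {m} (row a) (row g₀)) (cong₂ _+_ (Σ²-row {m = m} a) (Σ²-row {m = m} g₀))
    ℓ≤F : ∀ v → ℓ v ≤ F v
    ℓ≤F (g , h) with eqFin g a in g≡a | eqFin g g₀ in g≡g₀
    ... | true  | true  = ⊥-elim (g₀≢a (trans (≡-sym (eqFin-true {a = g} g≡g₀)) (eqFin-true g≡a)))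
    ... | true  | false = in-row g≡a (nonzero⇒1≤ (row-a-nonzero h))
    ... | false | true  = in-row g≡g₀ (nonzero⇒1≤ (row-g₀-nonzero h))
    ... | false | false = z≤n
    x-bonus : ∀ {b} → f (a , b) ≡ L2 → 1 + ℓ (a , b) ≤ F (a , b)
    x-bonus fx≡2 rewrite eqFin-refl a | eqFin-≢ (≢-sym g₀≢a) = two⇒2≤ fx≡2
    y-bonus : ∀ {x y} → Adj× G H (a , x) y → f y ≢ L0 → 1 + ℓ y ≤ F y
    y-bonus x~y fy≢0 rewrite eqFin-≢ (≢-sym (adj≢G (proj₁ x~y))) | eqFin-≢ (λ e → a≁g₀ (subst (Adj G a) e (proj₁ x~y)))
      = nonzero⇒1≤ fy≢0
    -- Either y₁ ≠ y₂, or y₁ = y₂ is adjacent to x₁ and x₂ and then m ≥ 3.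
    byCoincidence : Dec (y₁ ≡ y₂) → 8 ≤ W
    byCoincidence (no y₁≢y₂) = ≤-trans (+-monoˡ-≤ 4 (+-mono-≤ 2≤m 2≤m)) (subst (_≤ W) (cong (_+ 4) Σℓ) bound)
      where
      2≤m : 2 ≤ m
      2≤m = two-distinct⇒2≤ b₁≢b₂
      bound : Σ² ℓ + 4 ≤ W
      bound = Σ²-lowerBound ℓ F ℓ≤F ((x₁ , 1) ∷ (x₂ , 1) ∷ (y₁ , 1) ∷ (y₂ , 1) ∷ [])
        ((≢col b₁≢b₂ ∷ ≢row (adj≢G (proj₁ x₁~y₁)) ∷ ≢row (adj≢G (proj₁ x₂~y₂)) ∷ []) ∷
         (≢row (adj≢G (proj₁ x₁~y₁)) ∷ ≢row (adj≢G (proj₁ x₂~y₂)) ∷ []) ∷ (y₁≢y₂ ∷ []) ∷ [] ∷ [])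
        (x-bonus f₁ ∷ x-bonus f₂ ∷ y-bonus x₁~y₁ fy₁≢0 ∷ y-bonus x₂~y₂ fy₂≢0 ∷ [])
    byCoincidence (yes y₁≡y₂) =
      ≤-trans (decide≤ {8} {9}) (≤-trans (+-monoˡ-≤ 3 (+-mono-≤ 3≤m 3≤m)) (subst (_≤ W) (cong (_+ 3) Σℓ) bound))
      where
      x₂~y₁ : Adj× G H x₂ y₁
      x₂~y₁ = subst (Adj× G H x₂) (≡-sym y₁≡y₂) x₂~y₂
      -- y₁₂ is adjacent to both b₁ and b₂.
      3≤m : 3 ≤ m
      3≤m = three-distinct⇒3≤ (≢-sym (adj≢H (proj₂ x₁~y₁))) (≢-sym (adj≢H (proj₂ x₂~y₁))) b₁≢b₂
      bound : Σ² ℓ + 3 ≤ W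
      bound = Σ²-lowerBound ℓ F ℓ≤F ((x₁ , 1) ∷ (x₂ , 1) ∷ (y₁ , 1) ∷ [])
        ((≢col b₁≢b₂ ∷ ≢row (adj≢G (proj₁ x₁~y₁)) ∷ []) ∷ (≢row (adj≢G (proj₁ x₁~y₁)) ∷ []) ∷ [] ∷ [])
        (x-bonus f₁ ∷ x-bonus f₂ ∷ y-bonus x₁~y₁ fy₁≢0 ∷ [])

  result : LowerBound G H W
  result with 2≤⇒2or3or4≤ (two-distinct⇒2≤ b₁≢b₂) | universal? G a
  ... | inj₂ (inj₂ 4≤m) | _          = inj₂ (inj₂ (inj₂ (≤-trans (+-monoˡ-≤ 4 4≤m) W≥m+4)))
  ... | _               | no ¬a-univ =
    let (g₀ , g₀≢a , a≁g₀) = nonNeighbour G ¬a-univ in inj₂ (inj₂ (inj₂ (W≥8 g₀ g₀≢a a≁g₀)))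
  ... | inj₂ (inj₁ m≡3) | yes a-univ =
    inj₂ (inj₂ (inj₁ (((a , a-univ) , order3⇒hasUniversal H noH m≡3) , subst (λ k → k + 4 ≤ W) m≡3 W≥m+4)))
  ... | inj₁ m≡2        | yes a-univ with 2≤⇒2or3≤ (noIsolated⇒2≤ G noG a)
  ...   | inj₁ n≡2 = inj₁ (n≡2 , m≡2 , ≤-trans (+-monoˡ-≤ 4 (z≤n {m})) W≥m+4)
  ...   | inj₂ 3≤n = inj₂ (inj₁ (inj₂ (inj₁ (inj₂ (order2⇒K₂ H noH m≡2 , 3≤n , (a , a-univ)))) ,
                           ≤-trans (+-monoˡ-≤ 4 (two-distinct⇒2≤ b₁≢b₂)) W≥m+4))

⊎-swap₁₂ : ∀ {A B C : Set} → A ⊎ B ⊎ C → B ⊎ A ⊎ C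
⊎-swap₁₂ (inj₁ a)        = inj₂ (inj₁ a)
⊎-swap₁₂ (inj₂ (inj₁ b)) = inj₁ b
⊎-swap₁₂ (inj₂ (inj₂ c)) = inj₂ (inj₂ c)

two-of-three : ∀ {A B C : Set} → A ⊎ B → A ⊎ C → B ⊎ C → (A × B) ⊎ (A × C) ⊎ (B × C)
two-of-three (inj₁ a) (inj₁ _) (inj₁ b) = inj₁ (a , b)
two-of-three (inj₁ a) _        (inj₂ c) = inj₂ (inj₁ (a , c))
two-of-three (inj₁ a) (inj₂ c) _        = inj₂ (inj₁ (a , c))
two-of-three (inj₂ b) (inj₁ a) _        = inj₁ (a , b)
two-of-three (inj₂ b) (inj₂ c) _        = inj₂ (inj₂ (b , c))

pigeonhole : ∀ {A B C D E F : Set} → (A × B) ⊎ (A × C) ⊎ (B × C) → (D × E) ⊎ (D × F) ⊎ (E × F) →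
             ¬ (A × D) → ¬ (B × E) → ¬ (C × F) → ⊥
pigeonhole (inj₁ (a , b))        (inj₁ (d , e))        ¬AD ¬BE ¬CF = ¬AD (a , d)
pigeonhole (inj₁ (a , b))        (inj₂ (inj₁ (d , f))) ¬AD ¬BE ¬CF = ¬AD (a , d)
pigeonhole (inj₁ (a , b))        (inj₂ (inj₂ (e , f))) ¬AD ¬BE ¬CF = ¬BE (b , e)
pigeonhole (inj₂ (inj₁ (a , c))) (inj₁ (d , e))        ¬AD ¬BE ¬CF = ¬AD (a , d)
pigeonhole (inj₂ (inj₁ (a , c))) (inj₂ (inj₁ (d , f))) ¬AD ¬BE ¬CF = ¬AD (a , d)
pigeonhole (inj₂ (inj₁ (a , c))) (inj₂ (inj₂ (e , f))) ¬AD ¬BE ¬CF = ¬CF (c , f)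
pigeonhole (inj₂ (inj₂ (b , c))) (inj₁ (d , e))        ¬AD ¬BE ¬CF = ¬BE (b , e)
pigeonhole (inj₂ (inj₂ (b , c))) (inj₂ (inj₁ (d , f))) ¬AD ¬BE ¬CF = ¬CF (c , f)
pigeonhole (inj₂ (inj₂ (b , c))) (inj₂ (inj₂ (e , f))) ¬AD ¬BE ¬CF = ¬BE (b , e)

module ThreeTwos {n m} (G : Graph n) (H : Graph m) (f : V {n} {m} → Label) (tr : TRDF× G H f) where
  open Labelled G H f tr

  sym× : ∀ {v w} → Adj× G H v w → Adj× G H w v
  sym× (g~g' , h~h') = sym G g~g' , sym H h~h'

  adj×? : ∀ v w → Dec (Adj× G H v w)
  adj×? v w = dec G _ _ ×-dec dec H _ _

  -- The analysis for one ordering u1, u2, u3 of the vertices labelled 2; it is applied to all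
  -- orderings.
  module Ordered (u1 u2 u3 y : V) (f-u3 : f u3 ≡ L2)
    (dom-u : ∀ v → f v ≡ L0 → Adj× G H v u1 ⊎ Adj× G H v u2 ⊎ Adj× G H v u3)
    (nonzero⊆ : ∀ v → f v ≢ L0 → v ≡ u1 ⊎ v ≡ u2 ⊎ v ≡ u3 ⊎ v ≡ y) where

    g1 g2 g3 gy : Fin n
    g1 = proj₁ u1
    g2 = proj₁ u2
    g3 = proj₁ u3
    gy = proj₁ y

    h1 h2 h3 hy : Fin m
    h1 = proj₂ u1
    h2 = proj₂ u2
    h3 = proj₂ u3
    hy = proj₂ y

    covered : ∀ v → (Adj× G H v u1 ⊎ Adj× G H v u2 ⊎ Adj× G H v u3) ⊎ (f v ≢ L0 × (v ≡ u1 ⊎ v ≡ u2 ⊎ v ≡ u3 ⊎ v ≡ y))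
    covered v with f v ≟L L0
    ... | yes fv≡0 = inj₁ (dom-u v fv≡0)
    ... | no fv≢0  = inj₂ (fv≢0 , nonzero⊆ v fv≢0)

    irreflG : ∀ {a b} → a ≡ b → ¬ Adj G a b
    irreflG refl = irrefl G
    irreflH : ∀ {a b} → a ≡ b → ¬ Adj H a b
    irreflH refl = irrefl H

    y-neighbour : ∀ {v} → v ≡ y → f v ≢ L0 → Σ V λ w → Adj× G H v w × (w ≡ u1 ⊎ w ≡ u2 ⊎ w ≡ u3)
    y-neighbour {v} e nz with dom₊ v nz
    ... | w , a , wn with nonzero⊆ w wn
    ...   | inj₁ x = w , a , inj₁ x
    ...   | inj₂ (inj₁ x) = w , a , inj₂ (inj₁ x)
    ...   | inj₂ (inj₂ (inj₁ x)) = w , a , inj₂ (inj₂ x)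
    ...   | inj₂ (inj₂ (inj₂ x)) = ⊥-elim (irrefl G (subst (λ z → Adj G (proj₁ v) (proj₁ z)) (trans x (≡-sym e)) (proj₁ a)))

    -- If u1 is adjacent to u2 and u3, no g is adjacent to g1 but to neither g2 nor g3:
    -- the vertex (g , h1) could neither be dominated nor be nonzero.
    ¬adjOnly₁ : ∀ g → Adj G g g1 → ¬ Adj G g g2 → ¬ Adj G g g3 → Adj× G H u1 u2 → Adj× G H u1 u3 → ⊥
    ¬adjOnly₁ g g~g1 g≁g2 g≁g3 u1~u2 u1~u3 with covered (g , h1)
    ... | inj₁ (inj₁ (_ , hh)) = irrefl H hh
    ... | inj₁ (inj₂ (inj₁ (gg , _))) = g≁g2 gg
    ... | inj₁ (inj₂ (inj₂ (gg , _))) = g≁g3 gg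
    ... | inj₂ (_ , inj₁ e) = irreflG (cong proj₁ e) g~g1
    ... | inj₂ (_ , inj₂ (inj₁ e)) = irreflH (cong proj₂ e) (proj₂ u1~u2)
    ... | inj₂ (_ , inj₂ (inj₂ (inj₁ e))) = irreflH (cong proj₂ e) (proj₂ u1~u3)
    ... | inj₂ (nz , inj₂ (inj₂ (inj₂ e))) with y-neighbour e nz
    ...   | w , a , inj₁ refl = irrefl H (proj₂ a)
    ...   | w , a , inj₂ (inj₁ refl) = g≁g2 (proj₁ a)
    ...   | w , a , inj₂ (inj₂ refl) = g≁g3 (proj₁ a)

    -- If the ui form a triangle, every g is adjacent to some gi: otherwise both
    -- (g , h1) and (g , h2) would have to be y, although h1 ≠ h2.
    ¬adjNone : ∀ g → ¬ Adj G g g1 → ¬ Adj G g g2 → ¬ Adj G g g3 → Adj× G H u1 u2 → Adj× G H u1 u3 → Adj× G H u2 u3 → ⊥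
    ¬adjNone g g≁g1 g≁g2 g≁g3 u1~u2 u1~u3 u2~u3 = irreflH (trans (cong proj₂ c1y) (≡-sym (cong proj₂ c2y))) (proj₂ u1~u2)
      where
      c1y : (g , h1) ≡ y
      c1y with covered (g , h1)
      ... | inj₁ (inj₁ (gg , _)) = ⊥-elim (g≁g1 gg)
      ... | inj₁ (inj₂ (inj₁ (gg , _))) = ⊥-elim (g≁g2 gg)
      ... | inj₁ (inj₂ (inj₂ (gg , _))) = ⊥-elim (g≁g3 gg)
      ... | inj₂ (_ , inj₁ e) = ⊥-elim (g≁g2 (subst (λ z → Adj G z g2) (≡-sym (cong proj₁ e)) (proj₁ u1~u2)))
      ... | inj₂ (_ , inj₂ (inj₁ e)) = ⊥-elim (irreflH (cong proj₂ e) (proj₂ u1~u2))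
      ... | inj₂ (_ , inj₂ (inj₂ (inj₁ e))) = ⊥-elim (irreflH (cong proj₂ e) (proj₂ u1~u3))
      ... | inj₂ (_ , inj₂ (inj₂ (inj₂ e))) = e
      c2y : (g , h2) ≡ y
      c2y with covered (g , h2)
      ... | inj₁ (inj₁ (gg , _)) = ⊥-elim (g≁g1 gg)
      ... | inj₁ (inj₂ (inj₁ (gg , _))) = ⊥-elim (g≁g2 gg)
      ... | inj₁ (inj₂ (inj₂ (gg , _))) = ⊥-elim (g≁g3 gg)
      ... | inj₂ (_ , inj₁ e) = ⊥-elim (irreflH (cong proj₂ e) (sym H (proj₂ u1~u2)))
      ... | inj₂ (_ , inj₂ (inj₁ e)) = ⊥-elim (g≁g1 (subst (λ z → Adj G z g1) (≡-sym (cong proj₁ e)) (sym G (proj₁ u1~u2))))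
      ... | inj₂ (_ , inj₂ (inj₂ (inj₁ e))) = ⊥-elim (irreflH (cong proj₂ e) (proj₂ u2~u3))
      ... | inj₂ (_ , inj₂ (inj₂ (inj₂ e))) = e

    -- If only the ui are nonzero and u1 is adjacent to u2 and u3, then u2 ~ u3
    -- (look at the vertices (g1 , h2) and (g2 , h1)).
    closed-triangle : (∀ v → f v ≢ L0 → v ≡ u1 ⊎ v ≡ u2 ⊎ v ≡ u3) → Adj× G H u1 u2 → Adj× G H u1 u3 → Adj× G H u2 u3
    closed-triangle only-u u1~u2 u1~u3 = gg , hh
      where
      hh : Adj H h2 h3
      hh with f (g1 , h2) ≟L L0
      ... | yes e with dom-u _ e
      ...   | inj₁ (x , _) = ⊥-elim (irrefl G x)
      ...   | inj₂ (inj₁ (_ , x)) = ⊥-elim (irrefl H x)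
      ...   | inj₂ (inj₂ (_ , x)) = x
      hh | no nz with only-u _ nz
      ...   | inj₁ e = ⊥-elim (irreflH (≡-sym (cong proj₂ e)) (proj₂ u1~u2))
      ...   | inj₂ (inj₁ e) = ⊥-elim (irreflG (cong proj₁ e) (proj₁ u1~u2))
      ...   | inj₂ (inj₂ e) = ⊥-elim (irreflG (cong proj₁ e) (proj₁ u1~u3))
      gg : Adj G g2 g3
      gg with f (g2 , h1) ≟L L0
      ... | yes e with dom-u _ e
      ...   | inj₁ (_ , x) = ⊥-elim (irrefl H x)
      ...   | inj₂ (inj₁ (x , _)) = ⊥-elim (irrefl G x)
      ...   | inj₂ (inj₂ (x , _)) = x
      gg | no nz with only-u _ nz
      ...   | inj₁ e = ⊥-elim (irreflG (≡-sym (cong proj₁ e)) (proj₁ u1~u2))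
      ...   | inj₂ (inj₁ e) = ⊥-elim (irreflH (cong proj₂ e) (proj₂ u1~u2))
      ...   | inj₂ (inj₂ e) = ⊥-elim (irreflH (cong proj₂ e) (proj₂ u1~u3))

    -- If y is adjacent to every ui, the vertex (g1 , hy) shows that g1 ~ g2 or g1 ~ g3,
    -- and (gy , h1) shows that h1 ~ h2 or h1 ~ h3.
    y-forces-edgeG : Adj× G H u1 y → Adj× G H u2 y → Adj× G H u3 y → Adj G g1 g2 ⊎ Adj G g1 g3
    y-forces-edgeG u1~y u2~y u3~y with covered (g1 , hy)
    ... | inj₁ (inj₁ (x , _)) = ⊥-elim (irrefl G x)
    ... | inj₁ (inj₂ (inj₁ (x , _))) = inj₁ x
    ... | inj₁ (inj₂ (inj₂ (x , _))) = inj₂ x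
    ... | inj₂ (_ , inj₁ e) = ⊥-elim (irreflH (≡-sym (cong proj₂ e)) (proj₂ u1~y))
    ... | inj₂ (_ , inj₂ (inj₁ e)) = ⊥-elim (irreflH (≡-sym (cong proj₂ e)) (proj₂ u2~y))
    ... | inj₂ (_ , inj₂ (inj₂ (inj₁ e))) = ⊥-elim (irreflH (≡-sym (cong proj₂ e)) (proj₂ u3~y))
    ... | inj₂ (_ , inj₂ (inj₂ (inj₂ e))) = ⊥-elim (irreflG (cong proj₁ e) (proj₁ u1~y))

    y-forces-edgeH : Adj× G H u1 y → Adj× G H u2 y → Adj× G H u3 y → Adj H h1 h2 ⊎ Adj H h1 h3
    y-forces-edgeH u1~y u2~y u3~y with covered (gy , h1)
    ... | inj₁ (inj₁ (_ , x)) = ⊥-elim (irrefl H x)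
    ... | inj₁ (inj₂ (inj₁ (_ , x))) = inj₁ x
    ... | inj₁ (inj₂ (inj₂ (_ , x))) = inj₂ x
    ... | inj₂ (_ , inj₁ e) = ⊥-elim (irreflG (≡-sym (cong proj₁ e)) (proj₁ u1~y))
    ... | inj₂ (_ , inj₂ (inj₁ e)) = ⊥-elim (irreflG (≡-sym (cong proj₁ e)) (proj₁ u2~y))
    ... | inj₂ (_ , inj₂ (inj₂ (inj₁ e))) = ⊥-elim (irreflG (≡-sym (cong proj₁ e)) (proj₁ u3~y))
    ... | inj₂ (_ , inj₂ (inj₂ (inj₂ e))) = ⊥-elim (irreflH (cong proj₂ e) (proj₂ u1~y))

    -- The vertices
    -- (g2 , h1) and (g1 , h2) must be y unless h1 ~ h3, resp. g1 ~ g3; as u1 ≁ u3 one of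
    -- them is y, and then (g2 , h1), resp. (g1 , h2), consists of universal vertices.
    module Path (u1~u2 : Adj× G H u1 u2) (u2~u3 : Adj× G H u2 u3) (u1≁u3 : ¬ Adj× G H u1 u3) where
      y-at-g2h1 : (g2 , h1) ≡ y → Adj G g1 g3 → BothUniversal G H
      y-at-g2h1 e a13 = (g2 , gu) , (h1 , hu)
        where
        nh : ¬ Adj H h1 h3
        nh x = u1≁u3 (a13 , x)
        e31 : h3 ≡ h1
        e31 with covered (g2 , h3)
        ... | inj₁ (inj₁ (_ , x)) = ⊥-elim (nh (sym H x))
        ... | inj₁ (inj₂ (inj₁ (x , _))) = ⊥-elim (irrefl G x)
        ... | inj₁ (inj₂ (inj₂ (_ , x))) = ⊥-elim (irrefl H x)
        ... | inj₂ (_ , inj₁ e') = ⊥-elim (irreflG (≡-sym (cong proj₁ e')) (proj₁ u1~u2))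
        ... | inj₂ (_ , inj₂ (inj₁ e')) = ⊥-elim (irreflH (≡-sym (cong proj₂ e')) (proj₂ u2~u3))
        ... | inj₂ (_ , inj₂ (inj₂ (inj₁ e'))) = ⊥-elim (irreflG (cong proj₁ e') (proj₁ u2~u3))
        ... | inj₂ (_ , inj₂ (inj₂ (inj₂ e'))) = cong proj₂ (trans e' (≡-sym e))
        hu : Universal H h1
        hu h hne with covered (g2 , h)
        ... | inj₁ (inj₁ (_ , x)) = sym H x
        ... | inj₁ (inj₂ (inj₁ (x , _))) = ⊥-elim (irrefl G x)
        ... | inj₁ (inj₂ (inj₂ (_ , x))) = sym H (subst (Adj H h) e31 x)
        ... | inj₂ (_ , inj₁ e') = ⊥-elim (irreflG (≡-sym (cong proj₁ e')) (proj₁ u1~u2))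
        ... | inj₂ (_ , inj₂ (inj₁ e')) = subst (Adj H h1) (≡-sym (cong proj₂ e')) (proj₂ u1~u2)
        ... | inj₂ (_ , inj₂ (inj₂ (inj₁ e'))) = ⊥-elim (irreflG (cong proj₁ e') (proj₁ u2~u3))
        ... | inj₂ (_ , inj₂ (inj₂ (inj₂ e'))) = ⊥-elim (hne (cong proj₂ (trans e' (≡-sym e))))
        gu : Universal G g2
        gu g gne with covered (g , h1)
        ... | inj₁ (inj₁ (_ , x)) = ⊥-elim (irrefl H x)
        ... | inj₁ (inj₂ (inj₁ (x , _))) = sym G x
        ... | inj₁ (inj₂ (inj₂ (_ , x))) = ⊥-elim (irreflH (≡-sym e31) x)
        ... | inj₂ (_ , inj₁ e') = subst (Adj G g2) (≡-sym (cong proj₁ e')) (sym G (proj₁ u1~u2))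
        ... | inj₂ (_ , inj₂ (inj₁ e')) = ⊥-elim (gne (cong proj₁ e'))
        ... | inj₂ (_ , inj₂ (inj₂ (inj₁ e'))) = subst (Adj G g2) (≡-sym (cong proj₁ e')) (proj₁ u2~u3)
        ... | inj₂ (_ , inj₂ (inj₂ (inj₂ e'))) = ⊥-elim (gne (cong proj₁ (trans e' (≡-sym e))))

      y-at-g1h2 : (g1 , h2) ≡ y → Adj H h1 h3 → BothUniversal G H
      y-at-g1h2 e a13 = (g1 , gu) , (h2 , hu)
        where
        ng : ¬ Adj G g1 g3
        ng x = u1≁u3 (x , a13)
        e31 : g3 ≡ g1
        e31 with covered (g3 , h2)
        ... | inj₁ (inj₁ (x , _)) = ⊥-elim (ng (sym G x))
        ... | inj₁ (inj₂ (inj₁ (_ , x))) = ⊥-elim (irrefl H x)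
        ... | inj₁ (inj₂ (inj₂ (x , _))) = ⊥-elim (irrefl G x)
        ... | inj₂ (_ , inj₁ e') = ⊥-elim (irreflH (≡-sym (cong proj₂ e')) (proj₂ u1~u2))
        ... | inj₂ (_ , inj₂ (inj₁ e')) = ⊥-elim (irreflG (≡-sym (cong proj₁ e')) (proj₁ u2~u3))
        ... | inj₂ (_ , inj₂ (inj₂ (inj₁ e'))) = ⊥-elim (irreflH (cong proj₂ e') (proj₂ u2~u3))
        ... | inj₂ (_ , inj₂ (inj₂ (inj₂ e'))) = cong proj₁ (trans e' (≡-sym e))
        gu : Universal G g1
        gu g gne with covered (g , h2)
        ... | inj₁ (inj₁ (x , _)) = sym G x
        ... | inj₁ (inj₂ (inj₁ (_ , x))) = ⊥-elim (irrefl H x)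
        ... | inj₁ (inj₂ (inj₂ (x , _))) = sym G (subst (Adj G g) e31 x)
        ... | inj₂ (_ , inj₁ e') = ⊥-elim (irreflH (≡-sym (cong proj₂ e')) (proj₂ u1~u2))
        ... | inj₂ (_ , inj₂ (inj₁ e')) = subst (Adj G g1) (≡-sym (cong proj₁ e')) (proj₁ u1~u2)
        ... | inj₂ (_ , inj₂ (inj₂ (inj₁ e'))) = ⊥-elim (irreflH (cong proj₂ e') (proj₂ u2~u3))
        ... | inj₂ (_ , inj₂ (inj₂ (inj₂ e'))) = ⊥-elim (gne (cong proj₁ (trans e' (≡-sym e))))
        hu : Universal H h2
        hu h hne with covered (g1 , h)
        ... | inj₁ (inj₁ (x , _)) = ⊥-elim (irrefl G x)
        ... | inj₁ (inj₂ (inj₁ (_ , x))) = sym H x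
        ... | inj₁ (inj₂ (inj₂ (x , _))) = ⊥-elim (irreflG (≡-sym e31) x)
        ... | inj₂ (_ , inj₁ e') = subst (Adj H h2) (≡-sym (cong proj₂ e')) (sym H (proj₂ u1~u2))
        ... | inj₂ (_ , inj₂ (inj₁ e')) = ⊥-elim (irreflG (cong proj₁ e') (proj₁ u1~u2))
        ... | inj₂ (_ , inj₂ (inj₂ (inj₁ e'))) = subst (Adj H h2) (≡-sym (cong proj₂ e')) (proj₂ u2~u3)
        ... | inj₂ (_ , inj₂ (inj₂ (inj₂ e'))) = ⊥-elim (hne (cong proj₂ (trans e' (≡-sym e))))

    path⇒bothUniversal : Adj× G H u1 u2 → Adj× G H u2 u3 → ¬ Adj× G H u1 u3 → BothUniversal G H
    path⇒bothUniversal u1~u2 u2~u3 u1≁u3 = cases q1c q2c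
      where
      open Path u1~u2 u2~u3 u1≁u3
      q1c : Adj H h1 h3 ⊎ (g2 , h1) ≡ y
      q1c with covered (g2 , h1)
      ... | inj₁ (inj₁ (_ , x)) = ⊥-elim (irrefl H x)
      ... | inj₁ (inj₂ (inj₁ (x , _))) = ⊥-elim (irrefl G x)
      ... | inj₁ (inj₂ (inj₂ (_ , x))) = inj₁ x
      ... | inj₂ (_ , inj₁ e) = ⊥-elim (irreflG (≡-sym (cong proj₁ e)) (proj₁ u1~u2))
      ... | inj₂ (_ , inj₂ (inj₁ e)) = ⊥-elim (irreflH (cong proj₂ e) (proj₂ u1~u2))
      ... | inj₂ (_ , inj₂ (inj₂ (inj₁ e))) = ⊥-elim (irreflG (cong proj₁ e) (proj₁ u2~u3))
      ... | inj₂ (_ , inj₂ (inj₂ (inj₂ e))) = inj₂ e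
      q2c : Adj G g1 g3 ⊎ (g1 , h2) ≡ y
      q2c with covered (g1 , h2)
      ... | inj₁ (inj₁ (x , _)) = ⊥-elim (irrefl G x)
      ... | inj₁ (inj₂ (inj₁ (_ , x))) = ⊥-elim (irrefl H x)
      ... | inj₁ (inj₂ (inj₂ (x , _))) = inj₁ x
      ... | inj₂ (_ , inj₁ e) = ⊥-elim (irreflH (≡-sym (cong proj₂ e)) (proj₂ u1~u2))
      ... | inj₂ (_ , inj₂ (inj₁ e)) = ⊥-elim (irreflG (cong proj₁ e) (proj₁ u1~u2))
      ... | inj₂ (_ , inj₂ (inj₂ (inj₁ e))) = ⊥-elim (irreflH (cong proj₂ e) (proj₂ u2~u3))
      ... | inj₂ (_ , inj₂ (inj₂ (inj₂ e))) = inj₂ e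
      cases : Adj H h1 h3 ⊎ (g2 , h1) ≡ y → Adj G g1 g3 ⊎ (g1 , h2) ≡ y → BothUniversal G H
      cases (inj₁ a) (inj₁ b) = ⊥-elim (u1≁u3 (b , a))
      cases (inj₂ e) (inj₁ b) = y-at-g2h1 e b
      cases (inj₁ a) (inj₂ e) = y-at-g1h2 e a
      cases (inj₂ e) (inj₂ e') = ⊥-elim (irreflG (cong proj₁ (trans e' (≡-sym e))) (proj₁ u1~u2))

    isolated⇒adj-y : ¬ Adj× G H u3 u1 → ¬ Adj× G H u3 u2 → Adj× G H u3 y
    isolated⇒adj-y u3≁u1 u3≁u2 with dom₊ u3 (two⇒nonzero f-u3)
    ... | w , a , wn with nonzero⊆ w wn
    ...   | inj₁ refl = ⊥-elim (u3≁u1 a)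
    ...   | inj₂ (inj₁ refl) = ⊥-elim (u3≁u2 a)
    ...   | inj₂ (inj₂ (inj₁ refl)) = ⊥-elim (irrefl G (proj₁ a))
    ...   | inj₂ (inj₂ (inj₂ refl)) = a

    corner⇒bothUniversal : Adj× G H u1 u2 → Adj× G H u3 y → (g1 , h2) ≡ u3 → BothUniversal G H
    corner⇒bothUniversal u1~u2 u3~y e = (g1 , gu) , (h2 , hu)
      where
      g3≡ : g3 ≡ g1
      g3≡ = ≡-sym (cong proj₁ e)
      h3≡ : h3 ≡ h2
      h3≡ = ≡-sym (cong proj₂ e)
      gu : Universal G g1
      gu g gne with covered (g , h2)
      ... | inj₁ (inj₁ (x , _)) = sym G x
      ... | inj₁ (inj₂ (inj₁ (_ , x))) = ⊥-elim (irrefl H x)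
      ... | inj₁ (inj₂ (inj₂ (_ , x))) = ⊥-elim (irreflH (≡-sym h3≡) x)
      ... | inj₂ (_ , inj₁ e') = ⊥-elim (irreflH (≡-sym (cong proj₂ e')) (proj₂ u1~u2))
      ... | inj₂ (_ , inj₂ (inj₁ e')) = subst (Adj G g1) (≡-sym (cong proj₁ e')) (proj₁ u1~u2)
      ... | inj₂ (_ , inj₂ (inj₂ (inj₁ e'))) = ⊥-elim (gne (trans (cong proj₁ e') g3≡))
      ... | inj₂ (_ , inj₂ (inj₂ (inj₂ e'))) = ⊥-elim (irreflH (trans h3≡ (cong proj₂ e')) (proj₂ u3~y))
      hu : Universal H h2
      hu h hne with covered (g1 , h)
      ... | inj₁ (inj₁ (x , _)) = ⊥-elim (irrefl G x)
      ... | inj₁ (inj₂ (inj₁ (_ , x))) = sym H x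
      ... | inj₁ (inj₂ (inj₂ (x , _))) = ⊥-elim (irreflG (≡-sym g3≡) x)
      ... | inj₂ (_ , inj₁ e') = subst (Adj H h2) (≡-sym (cong proj₂ e')) (sym H (proj₂ u1~u2))
      ... | inj₂ (_ , inj₂ (inj₁ e')) = ⊥-elim (irreflG (cong proj₁ e') (proj₁ u1~u2))
      ... | inj₂ (_ , inj₂ (inj₂ (inj₁ e'))) = ⊥-elim (hne (trans (cong proj₂ e') h3≡))
      ... | inj₂ (_ , inj₂ (inj₂ (inj₂ e'))) = ⊥-elim (irreflG (trans g3≡ (cong proj₁ e')) (proj₁ u3~y))

    -- An edge u1 u2 with u3 adjacent to neither forces universal vertices, unless u3 is the
    -- corner (g2 , h1), which is the previous lemma for the ordering u2, u1, u3.
    edge+isolated⇒bothUniversal : Adj× G H u1 u2 → ¬ Adj× G H u3 u1 → ¬ Adj× G H u3 u2 → BothUniversal G H ⊎ (g2 , h1) ≡ u3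
    edge+isolated⇒bothUniversal u1~u2 u3≁u1 u3≁u2 = cases cc cc'
      where
      u3~y : Adj× G H u3 y
      u3~y = isolated⇒adj-y u3≁u1 u3≁u2
      cc : (Adj G g1 g3 × Adj H h2 h3) ⊎ (g1 , h2) ≡ u3 ⊎ (g1 , h2) ≡ y
      cc with covered (g1 , h2)
      ... | inj₁ (inj₁ (x , _)) = ⊥-elim (irrefl G x)
      ... | inj₁ (inj₂ (inj₁ (_ , x))) = ⊥-elim (irrefl H x)
      ... | inj₁ (inj₂ (inj₂ x)) = inj₁ x
      ... | inj₂ (_ , inj₁ e) = ⊥-elim (irreflH (≡-sym (cong proj₂ e)) (proj₂ u1~u2))
      ... | inj₂ (_ , inj₂ (inj₁ e)) = ⊥-elim (irreflG (cong proj₁ e) (proj₁ u1~u2))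
      ... | inj₂ (_ , inj₂ (inj₂ (inj₁ e))) = inj₂ (inj₁ e)
      ... | inj₂ (_ , inj₂ (inj₂ (inj₂ e))) = inj₂ (inj₂ e)
      cc' : (Adj G g2 g3 × Adj H h1 h3) ⊎ (g2 , h1) ≡ u3 ⊎ (g2 , h1) ≡ y
      cc' with covered (g2 , h1)
      ... | inj₁ (inj₁ (_ , x)) = ⊥-elim (irrefl H x)
      ... | inj₁ (inj₂ (inj₁ (x , _))) = ⊥-elim (irrefl G x)
      ... | inj₁ (inj₂ (inj₂ x)) = inj₁ x
      ... | inj₂ (_ , inj₁ e) = ⊥-elim (irreflG (≡-sym (cong proj₁ e)) (proj₁ u1~u2))
      ... | inj₂ (_ , inj₂ (inj₁ e)) = ⊥-elim (irreflH (cong proj₂ e) (proj₂ u1~u2))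
      ... | inj₂ (_ , inj₂ (inj₂ (inj₁ e))) = inj₂ (inj₁ e)
      ... | inj₂ (_ , inj₂ (inj₂ (inj₂ e))) = inj₂ (inj₂ e)
      cases : (Adj G g1 g3 × Adj H h2 h3) ⊎ (g1 , h2) ≡ u3 ⊎ (g1 , h2) ≡ y →
              (Adj G g2 g3 × Adj H h1 h3) ⊎ (g2 , h1) ≡ u3 ⊎ (g2 , h1) ≡ y → BothUniversal G H ⊎ (g2 , h1) ≡ u3
      cases (inj₂ (inj₁ e)) _ = inj₁ (corner⇒bothUniversal u1~u2 u3~y e)
      cases _ (inj₂ (inj₁ e)) = inj₂ e
      cases (inj₁ (a , _)) (inj₁ (_ , b)) = ⊥-elim (u3≁u1 (sym G a , sym H b))
      cases (inj₁ (_ , b)) (inj₂ (inj₂ e)) =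
        ⊥-elim (u3≁u2 (subst (Adj G g3) (≡-sym (cong proj₁ e)) (proj₁ u3~y) , sym H b))
      cases (inj₂ (inj₂ e)) (inj₁ (_ , b)) =
        ⊥-elim (u3≁u1 (subst (Adj G g3) (≡-sym (cong proj₁ e)) (proj₁ u3~y) , sym H b))
      cases (inj₂ (inj₂ e)) (inj₂ (inj₂ e')) = ⊥-elim (irreflG (cong proj₁ (trans e (≡-sym e'))) (proj₁ u1~u2))


  module Analysis (x1 x2 x3 y : V) (f1 : f x1 ≡ L2) (f2 : f x2 ≡ L2) (f3 : f x3 ≡ L2)
    (only : ∀ v → f v ≡ L2 → v ≡ x1 ⊎ v ≡ x2 ⊎ v ≡ x3)
    (nonzero⊆ : ∀ v → f v ≢ L0 → v ≡ x1 ⊎ v ≡ x2 ⊎ v ≡ x3 ⊎ v ≡ y) where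

    dom-x : ∀ v → f v ≡ L0 → Adj× G H v x1 ⊎ Adj× G H v x2 ⊎ Adj× G H v x3
    dom-x v e with dom₀ v e
    ... | w , a , l with only w l
    ...   | inj₁ refl = inj₁ a
    ...   | inj₂ (inj₁ refl) = inj₂ (inj₁ a)
    ...   | inj₂ (inj₂ refl) = inj₂ (inj₂ a)

    module P123 = Ordered x1 x2 x3 y f3 dom-x nonzero⊆
    module P213 = Ordered x2 x1 x3 y f3 (λ v e → ⊎-swap₁₂ (dom-x v e)) (λ v e → ⊎-swap₁₂ (nonzero⊆ v e))
    module P132 = Ordered x1 x3 x2 y f2 (λ v e → map₂ swap⊎ (dom-x v e)) (λ v e → map₂ ⊎-swap₁₂ (nonzero⊆ v e))
    module P312 = Ordered x3 x1 x2 y f2 (λ v e → ⊎-swap₁₂ (map₂ swap⊎ (dom-x v e)))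
                                         (λ v e → ⊎-swap₁₂ (map₂ ⊎-swap₁₂ (nonzero⊆ v e)))
    module P231 = Ordered x2 x3 x1 y f1 (λ v e → map₂ swap⊎ (⊎-swap₁₂ (dom-x v e)))
                                         (λ v e → map₂ ⊎-swap₁₂ (⊎-swap₁₂ (nonzero⊆ v e)))
    module P321 = Ordered x3 x2 x1 y f1 (λ v e → ⊎-swap₁₂ (map₂ swap⊎ (⊎-swap₁₂ (dom-x v e))))
                                         (λ v e → ⊎-swap₁₂ (map₂ ⊎-swap₁₂ (⊎-swap₁₂ (nonzero⊆ v e))))

    triangle⇒centeredG : Adj× G H x1 x2 → Adj× G H x1 x3 → Adj× G H x2 x3 → TriangleCentered G
    triangle⇒centeredG x1~x2 x1~x3 x2~x3 = proj₁ x1 , proj₁ x2 , proj₁ x3 , proj₁ x1~x2 , proj₁ x2~x3 , proj₁ x1~x3 , cl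
      where
      cl : ∀ g → (Adj G g (proj₁ x1) × Adj G g (proj₁ x2)) ⊎ (Adj G g (proj₁ x1) × Adj G g (proj₁ x3))
                 ⊎ (Adj G g (proj₁ x2) × Adj G g (proj₁ x3))
      cl g with dec G g (proj₁ x1) | dec G g (proj₁ x2) | dec G g (proj₁ x3)
      ... | yes a | yes b | _ = inj₁ (a , b)
      ... | yes a | no _ | yes c = inj₂ (inj₁ (a , c))
      ... | no _ | yes b | yes c = inj₂ (inj₂ (b , c))
      ... | yes a | no nb | no nc = ⊥-elim (P123.¬adjOnly₁ g a nb nc x1~x2 x1~x3)
      ... | no na | yes b | no nc = ⊥-elim (P213.¬adjOnly₁ g b na nc (sym× x1~x2) x2~x3)
      ... | no na | no nb | yes c = ⊥-elim (P312.¬adjOnly₁ g c na nb (sym× x1~x3) (sym× x2~x3))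
      ... | no na | no nb | no nc = ⊥-elim (P123.¬adjNone g na nb nc x1~x2 x1~x3 x2~x3)

    -- If the xi are the only nonzero vertices, each has a neighbour among the others, and
    -- then they are pairwise adjacent.
    threeNonzero⇒triangle : (∀ v → f v ≢ L0 → v ≡ x1 ⊎ v ≡ x2 ⊎ v ≡ x3) →
                            Adj× G H x1 x2 × Adj× G H x1 x3 × Adj× G H x2 x3
    threeNonzero⇒triangle only-x = go nb1 nb2 nb3
      where
      nbr : ∀ {v} → f v ≡ L2 → Σ V λ w → Adj× G H v w × (w ≡ x1 ⊎ w ≡ x2 ⊎ w ≡ x3)
      nbr {v} fv with dom₊ v (two⇒nonzero fv)
      ... | w , a , wn = w , a , only-x w wn
      nb1 : Adj× G H x1 x2 ⊎ Adj× G H x1 x3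
      nb1 with nbr f1
      ... | w , a , inj₁ refl = ⊥-elim (irrefl G (proj₁ a))
      ... | w , a , inj₂ (inj₁ refl) = inj₁ a
      ... | w , a , inj₂ (inj₂ refl) = inj₂ a
      nb2 : Adj× G H x2 x1 ⊎ Adj× G H x2 x3
      nb2 with nbr f2
      ... | w , a , inj₁ refl = inj₁ a
      ... | w , a , inj₂ (inj₁ refl) = ⊥-elim (irrefl G (proj₁ a))
      ... | w , a , inj₂ (inj₂ refl) = inj₂ a
      nb3 : Adj× G H x3 x1 ⊎ Adj× G H x3 x2
      nb3 with nbr f3
      ... | w , a , inj₁ refl = inj₁ a
      ... | w , a , inj₂ (inj₁ refl) = inj₂ a
      ... | w , a , inj₂ (inj₂ refl) = ⊥-elim (irrefl G (proj₁ a))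
      go : Adj× G H x1 x2 ⊎ Adj× G H x1 x3 → Adj× G H x2 x1 ⊎ Adj× G H x2 x3 → Adj× G H x3 x1 ⊎ Adj× G H x3 x2 →
           Adj× G H x1 x2 × Adj× G H x1 x3 × Adj× G H x2 x3
      go (inj₁ x1~x2) _ (inj₁ x3~x1) = x1~x2 , sym× x3~x1 , P123.closed-triangle only-x x1~x2 (sym× x3~x1)
      go (inj₁ x1~x2) _ (inj₂ x3~x2) = x1~x2 , P213.closed-triangle (λ v e → ⊎-swap₁₂ (only-x v e)) (sym× x1~x2) (sym× x3~x2) , sym× x3~x2
      go (inj₂ x1~x3) (inj₁ x2~x1) _ = sym× x2~x1 , x1~x3 , P123.closed-triangle only-x (sym× x2~x1) x1~x3
      go (inj₂ x1~x3) (inj₂ x2~x3) _ =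
        P312.closed-triangle (λ v e → ⊎-swap₁₂ (map₂ swap⊎ (only-x v e))) (sym× x1~x3) (sym× x2~x3) , x1~x3 , x2~x3

    -- With one further nonzero vertex y: either the xi are pairwise adjacent, or both graphs
    -- have universal vertices (an edgeless x1, x2, x3 is impossible by 'pigeonhole').
    fourNonzero⇒triangle-or-universal : (Adj× G H x1 x2 × Adj× G H x1 x3 × Adj× G H x2 x3) ⊎ BothUniversal G H
    fourNonzero⇒triangle-or-universal with adj×? x1 x2 | adj×? x1 x3 | adj×? x2 x3
    ... | yes x1~x2 | yes x1~x3 | yes x2~x3 = inj₁ (x1~x2 , x1~x3 , x2~x3)
    ... | yes x1~x2 | yes x1~x3 | no x2≁x3 = inj₂ (P213.path⇒bothUniversal (sym× x1~x2) x1~x3 x2≁x3)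
    ... | yes x1~x2 | no x1≁x3 | yes x2~x3 = inj₂ (P123.path⇒bothUniversal x1~x2 x2~x3 x1≁x3)
    ... | no x1≁x2 | yes x1~x3 | yes x2~x3 = inj₂ (P132.path⇒bothUniversal x1~x3 (sym× x2~x3) x1≁x2)
    ... | yes x1~x2 | no x1≁x3 | no x2≁x3 with P123.edge+isolated⇒bothUniversal x1~x2 (λ a → x1≁x3 (sym× a)) (λ a → x2≁x3 (sym× a))
    ...   | inj₁ r = inj₂ r
    ...   | inj₂ e =
      inj₂ (P213.corner⇒bothUniversal (sym× x1~x2) (P123.isolated⇒adj-y (λ a → x1≁x3 (sym× a)) (λ a → x2≁x3 (sym× a))) e)
    fourNonzero⇒triangle-or-universal | no x1≁x2 | yes x1~x3 | no x2≁x3 with P132.edge+isolated⇒bothUniversal x1~x3 (λ a → x1≁x2 (sym× a)) x2≁x3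
    ...   | inj₁ r = inj₂ r
    ...   | inj₂ e = inj₂ (P312.corner⇒bothUniversal (sym× x1~x3) (P132.isolated⇒adj-y (λ a → x1≁x2 (sym× a)) x2≁x3) e)
    fourNonzero⇒triangle-or-universal | no x1≁x2 | no x1≁x3 | yes x2~x3 with P231.edge+isolated⇒bothUniversal x2~x3 x1≁x2 x1≁x3
    ...   | inj₁ r = inj₂ r
    ...   | inj₂ e = inj₂ (P321.corner⇒bothUniversal (sym× x2~x3) (P231.isolated⇒adj-y x1≁x2 x1≁x3) e)
    fourNonzero⇒triangle-or-universal | no x1≁x2 | no x1≁x3 | no x2≁x3 =
      ⊥-elim (pigeonhole (two-of-three gA gB gC) (two-of-three hA hB hC) x1≁x2 x1≁x3 x2≁x3)
      where
      x1~y : Adj× G H x1 y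
      x1~y = P231.isolated⇒adj-y x1≁x2 x1≁x3
      x2~y : Adj× G H x2 y
      x2~y = P312.isolated⇒adj-y x2≁x3 (λ a → x1≁x2 (sym× a))
      x3~y : Adj× G H x3 y
      x3~y = P123.isolated⇒adj-y (λ a → x1≁x3 (sym× a)) (λ a → x2≁x3 (sym× a))
      gA : Adj G (proj₁ x1) (proj₁ x2) ⊎ Adj G (proj₁ x1) (proj₁ x3)
      gA = P123.y-forces-edgeG x1~y x2~y x3~y
      gB : Adj G (proj₁ x1) (proj₁ x2) ⊎ Adj G (proj₁ x2) (proj₁ x3)
      gB = map₁ (sym G) (P213.y-forces-edgeG x2~y x1~y x3~y)
      gC : Adj G (proj₁ x1) (proj₁ x3) ⊎ Adj G (proj₁ x2) (proj₁ x3)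
      gC = map⊎ (sym G) (sym G) (P312.y-forces-edgeG x3~y x1~y x2~y)
      hA : Adj H (proj₂ x1) (proj₂ x2) ⊎ Adj H (proj₂ x1) (proj₂ x3)
      hA = P123.y-forces-edgeH x1~y x2~y x3~y
      hB : Adj H (proj₂ x1) (proj₂ x2) ⊎ Adj H (proj₂ x2) (proj₂ x3)
      hB = map₁ (sym H) (P213.y-forces-edgeH x2~y x1~y x3~y)
      hC : Adj H (proj₂ x1) (proj₂ x3) ⊎ Adj H (proj₂ x2) (proj₂ x3)
      hC = map⊎ (sym H) (sym H) (P312.y-forces-edgeH x3~y x1~y x2~y)

-- Three pairwise adjacent vertices labelled 2 centre triangles in both factors; the
-- statement for H is the one for G applied to the transposed labelling of H × G.
triangle⇒centered : ∀ {n m} (G : Graph n) (H : Graph m) f (tr : TRDF× G H f) (x1 x2 x3 y : V {n} {m}) →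
  f x1 ≡ L2 → f x2 ≡ L2 → f x3 ≡ L2 →
  (∀ v → f v ≡ L2 → v ≡ x1 ⊎ v ≡ x2 ⊎ v ≡ x3) →
  (∀ v → f v ≢ L0 → v ≡ x1 ⊎ v ≡ x2 ⊎ v ≡ x3 ⊎ v ≡ y) →
  Adj× G H x1 x2 → Adj× G H x1 x3 → Adj× G H x2 x3 → TriangleCentered G × TriangleCentered H
triangle⇒centered G H f tr x1 x2 x3 y f1 f2 f3 only nonzero⊆ x1~x2 x1~x3 x2~x3 =
  ThreeTwos.Analysis.triangle⇒centeredG G H f tr x1 x2 x3 y f1 f2 f3 only nonzero⊆ x1~x2 x1~x3 x2~x3 ,
  ThreeTwos.Analysis.triangle⇒centeredG H G (f ∘ swap) (transpose-TRDF G H f tr)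
    (swap x1) (swap x2) (swap x3) (swap y) f1 f2 f3
    (λ w fw≡2 → map⊎ (cong swap) (map⊎ (cong swap) (cong swap)) (only (swap w) fw≡2))
    (λ w fw≢0 → map⊎ (cong swap) (map⊎ (cong swap) (map⊎ (cong swap) (cong swap))) (nonzero⊆ (swap w) fw≢0))
    (transposed x1~x2) (transposed x1~x3) (transposed x2~x3)
  where
  transposed : ∀ {v w} → Adj× G H v w → Adj× H G (swap v) (swap w)
  transposed (g~g' , h~h') = h~h' , g~g'

module Classify {n m} (G : Graph n) (H : Graph m) (noG : NoIsolated G) (noH : NoIsolated H)
                (2≤n : 2 ≤ n) (2≤m : 2 ≤ m) (f : V {n} {m} → Label) (tr : TRDF× G H f) where
  open Labelled G H f tr

  -- Three vertices labelled 2. Without any vertex labelled 1 they form a triangle of weight 6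
  -- centring triangles in G and H; with two vertices labelled 1 the weight is 8; with exactly
  -- one it is 7, and we get a triangle or universal vertices.
  module Three (x1 x2 x3 : V) (f1 : f x1 ≡ L2) (f2 : f x2 ≡ L2) (f3 : f x3 ≡ L2)
               (x1≢x2 : x1 ≢ x2) (x1≢x3 : x1 ≢ x3) (x2≢x3 : x2 ≢ x3)
               (only : ∀ v → f v ≡ L2 → v ≡ x1 ⊎ v ≡ x2 ⊎ v ≡ x3) where

    noOne : (∀ v → f v ≢ L1) → LowerBound G H W
    noOne ¬one = inj₂ (inj₁ (inj₂ (inj₂ centred) , W≥6))
      where
      only-x : ∀ v → f v ≢ L0 → v ≡ x1 ⊎ v ≡ x2 ⊎ v ≡ x3
      only-x v fv≢0 with f v in fv
      ... | L0 = ⊥-elim (fv≢0 refl)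
      ... | L1 = ⊥-elim (¬one v fv)
      ... | L2 = only v fv
      nonzero⊆ : ∀ v → f v ≢ L0 → v ≡ x1 ⊎ v ≡ x2 ⊎ v ≡ x3 ⊎ v ≡ x1
      nonzero⊆ v fv≢0 = map₂ (map₂ inj₁) (only-x v fv≢0)
      centred : TriangleCentered G × TriangleCentered H
      centred with ThreeTwos.Analysis.threeNonzero⇒triangle G H f tr x1 x2 x3 x1 f1 f2 f3 only nonzero⊆ only-x
      ... | x1~x2 , x1~x3 , x2~x3 = triangle⇒centered G H f tr x1 x2 x3 x1 f1 f2 f3 only nonzero⊆ x1~x2 x1~x3 x2~x3
      W≥6 : 6 ≤ W
      W≥6 = W≥points ((x1 , 2) ∷ (x2 , 2) ∷ (x3 , 2) ∷ []) ((x1≢x2 ∷ x1≢x3 ∷ []) ∷ (x2≢x3 ∷ []) ∷ [] ∷ [])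
              (two⇒2≤ f1 ∷ two⇒2≤ f2 ∷ two⇒2≤ f3 ∷ [])

    twoOnes : ∀ {y y'} → f y ≡ L1 → f y' ≡ L1 → y ≢ y' → 8 ≤ W
    twoOnes {y} {y'} fy≡1 fy'≡1 y≢y' = W≥points
      ((x1 , 2) ∷ (x2 , 2) ∷ (x3 , 2) ∷ (y , 1) ∷ (y' , 1) ∷ [])
      ((x1≢x2 ∷ x1≢x3 ∷ ≢-sym (one≢two fy≡1 f1) ∷ ≢-sym (one≢two fy'≡1 f1) ∷ []) ∷
       (x2≢x3 ∷ ≢-sym (one≢two fy≡1 f2) ∷ ≢-sym (one≢two fy'≡1 f2) ∷ []) ∷
       (≢-sym (one≢two fy≡1 f3) ∷ ≢-sym (one≢two fy'≡1 f3) ∷ []) ∷ (y≢y' ∷ []) ∷ [] ∷ [])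
      (two⇒2≤ f1 ∷ two⇒2≤ f2 ∷ two⇒2≤ f3 ∷ nonzero⇒1≤ (one⇒nonzero fy≡1) ∷ nonzero⇒1≤ (one⇒nonzero fy'≡1) ∷ [])

    oneOne : ∀ {y} → f y ≡ L1 → (∀ v → f v ≡ L1 → v ≡ y) → LowerBound G H W
    oneOne {y} fy≡1 onlyOne =
      conclude (ThreeTwos.Analysis.fourNonzero⇒triangle-or-universal G H f tr x1 x2 x3 y f1 f2 f3 only nonzero⊆)
      where
      nonzero⊆ : ∀ v → f v ≢ L0 → v ≡ x1 ⊎ v ≡ x2 ⊎ v ≡ x3 ⊎ v ≡ y
      nonzero⊆ v fv≢0 with f v in fv
      ... | L0 = ⊥-elim (fv≢0 refl)
      ... | L1 = inj₂ (inj₂ (inj₂ (onlyOne v fv)))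
      ... | L2 = map₂ (map₂ inj₁) (only v fv)
      W≥7 : 7 ≤ W
      W≥7 = W≥points ((x1 , 2) ∷ (x2 , 2) ∷ (x3 , 2) ∷ (y , 1) ∷ [])
              ((x1≢x2 ∷ x1≢x3 ∷ ≢-sym (one≢two fy≡1 f1) ∷ []) ∷ (x2≢x3 ∷ ≢-sym (one≢two fy≡1 f2) ∷ []) ∷
               (≢-sym (one≢two fy≡1 f3) ∷ []) ∷ [] ∷ [])
              (two⇒2≤ f1 ∷ two⇒2≤ f2 ∷ two⇒2≤ f3 ∷ nonzero⇒1≤ (one⇒nonzero fy≡1) ∷ [])
      conclude : (Adj× G H x1 x2 × Adj× G H x1 x3 × Adj× G H x2 x3) ⊎ BothUniversal G H → LowerBound G H W
      conclude (inj₁ (x1~x2 , x1~x3 , x2~x3)) =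
        inj₂ (inj₁ (inj₂ (inj₂ (triangle⇒centered G H f tr x1 x2 x3 y f1 f2 f3 only nonzero⊆ x1~x2 x1~x3 x2~x3)) ,
                    ≤-trans (n≤1+n 6) W≥7))
      conclude (inj₂ both) = inj₂ (inj₂ (inj₁ (both , W≥7)))

    result : LowerBound G H W
    result with any-cell? (λ v → f v ≟L L1)
    ... | no ¬one = noOne (λ v fv≡1 → ¬one (v , fv≡1))
    ... | yes (y , fy≡1) with any-cell? (λ v → (f v ≟L L1) ×-dec ¬? (v ≟V y))
    ...   | yes (y' , fy'≡1 , y'≢y) = inj₂ (inj₂ (inj₂ (twoOnes fy≡1 fy'≡1 (≢-sym y'≢y))))
    ...   | no ¬other = oneOne fy≡1 onlyOne
      where
      onlyOne : ∀ v → f v ≡ L1 → v ≡ y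
      onlyOne v fv≡1 with v ≟V y
      ... | yes v≡y = v≡y
      ... | no v≢y  = ⊥-elim (¬other (v , fv≡1 , v≢y))

  twoTwos : ∀ a₁ b₁ a₂ b₂ → f (a₁ , b₁) ≡ L2 → f (a₂ , b₂) ≡ L2 → (a₁ , b₁) ≢ (a₂ , b₂) →
            (∀ v → f v ≡ L2 → v ≡ (a₁ , b₁) ⊎ v ≡ (a₂ , b₂)) → LowerBound G H W
  twoTwos a₁ b₁ a₂ b₂ f₁ f₂ x₁≢x₂ only with dec G a₁ a₂ ×-dec dec H b₁ b₂
  ... | yes (a₁~a₂ , b₁~b₂) = TwoTwos.Adjacent.result G H f tr a₁ a₂ b₁ b₂ f₁ f₂ x₁≢x₂ only a₁~a₂ b₁~b₂
  ... | no x₁≁x₂ with a₁ ≟ a₂ | b₁ ≟ b₂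
  ...   | yes refl | _        = SameRow.result G H noG noH f tr a₁ b₁ b₂ f₁ f₂ (λ b₁≡b₂ → x₁≢x₂ (cong (a₁ ,_) b₁≡b₂)) only
  ...   | no a₁≢a₂ | yes refl = LowerBound-transpose G H W (subst (LowerBound H G) (transpose-wt G H f)
      (SameRow.result H G noH noG (f ∘ swap) (transpose-TRDF G H f tr) b₁ a₁ a₂ f₁ f₂ a₁≢a₂
                      (λ w fw≡2 → map⊎ (cong swap) (cong swap) (only (swap w) fw≡2))))
  ...   | no a₁≢a₂ | no b₁≢b₂ =
    inj₂ (inj₂ (inj₂ (TwoTwos.Apart.result G H f tr a₁ a₂ b₁ b₂ f₁ f₂ x₁≢x₂ only a₁≢a₂ b₁≢b₂ x₁≁x₂)))

  -- Four vertices labelled 2 already weigh 8; fewer are handled above.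
  result : LowerBound G H W
  result with any-cell? (λ v → f v ≟L L2)
  ... | no noTwo = noTwo⇒LowerBound G H noG noH f tr 2≤n 2≤m (λ v fv≡2 → noTwo (v , fv≡2))
  ... | yes (x1 , f1) with any-cell? (λ v → (f v ≟L L2) ×-dec ¬? (v ≟V x1))
  ...   | no noSecond = oneTwo⇒LowerBound G H noG noH f tr 2≤n 2≤m (proj₁ x1) (proj₂ x1) f1 only
    where
    only : ∀ v → f v ≡ L2 → v ≡ x1
    only v fv≡2 with v ≟V x1
    ... | yes v≡x1 = v≡x1
    ... | no v≢x1  = ⊥-elim (noSecond (v , fv≡2 , v≢x1))
  ...   | yes (x2 , f2 , x2≢x1) with any-cell? (λ v → (f v ≟L L2) ×-dec ¬? (v ≟V x1) ×-dec ¬? (v ≟V x2))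
  ...     | no noThird = twoTwos (proj₁ x1) (proj₂ x1) (proj₁ x2) (proj₂ x2) f1 f2 (≢-sym x2≢x1) only
    where
    only : ∀ v → f v ≡ L2 → v ≡ x1 ⊎ v ≡ x2
    only v fv≡2 with v ≟V x1 | v ≟V x2
    ... | yes v≡x1 | _        = inj₁ v≡x1
    ... | no _     | yes v≡x2 = inj₂ v≡x2
    ... | no v≢x1  | no v≢x2  = ⊥-elim (noThird (v , fv≡2 , v≢x1 , v≢x2))
  ...     | yes (x3 , f3 , x3≢x1 , x3≢x2)
    with any-cell? (λ v → (f v ≟L L2) ×-dec ¬? (v ≟V x1) ×-dec ¬? (v ≟V x2) ×-dec ¬? (v ≟V x3))
  ...       | yes (x4 , f4 , x4≢x1 , x4≢x2 , x4≢x3) =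
    inj₂ (inj₂ (inj₂ (W≥points ((x1 , 2) ∷ (x2 , 2) ∷ (x3 , 2) ∷ (x4 , 2) ∷ [])
                ((≢-sym x2≢x1 ∷ ≢-sym x3≢x1 ∷ ≢-sym x4≢x1 ∷ []) ∷ (≢-sym x3≢x2 ∷ ≢-sym x4≢x2 ∷ []) ∷ (≢-sym x4≢x3 ∷ []) ∷ [] ∷ [])
                (two⇒2≤ f1 ∷ two⇒2≤ f2 ∷ two⇒2≤ f3 ∷ two⇒2≤ f4 ∷ []))))
  ...       | no noFourth = Three.result x1 x2 x3 f1 f2 f3 (≢-sym x2≢x1) (≢-sym x3≢x1) (≢-sym x3≢x2) only
    where
    only : ∀ v → f v ≡ L2 → v ≡ x1 ⊎ v ≡ x2 ⊎ v ≡ x3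
    only v fv≡2 with v ≟V x1 | v ≟V x2 | v ≟V x3
    ... | yes v≡x1 | _        | _        = inj₁ v≡x1
    ... | no _     | yes v≡x2 | _        = inj₂ (inj₁ v≡x2)
    ... | no _     | no _     | yes v≡x3 = inj₂ (inj₂ v≡x3)
    ... | no v≢x1  | no v≢x2  | no v≢x3  = ⊥-elim (noFourth (v , fv≡2 , v≢x1 , v≢x2 , v≢x3))

lowerBound : ∀ {n m} (G : Graph n) (H : Graph m) → NoIsolated G → NoIsolated H → Fin n → Fin m →
             ∀ f → TRDF× G H f → LowerBound G H (wt f)
lowerBound G H noG noH g h f tr =
  Classify.result G H noG noH (noIsolated⇒2≤ G noG g) (noIsolated⇒2≤ H noH h) f tr

Cond7 : ∀ {n m} (G : Graph n) (H : Graph m) → Set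
Cond7 G H = HasUniversal G × HasUniversal H
          × ((ExactlyOneUniversal G × ¬ IsK₂ H) ⊎ (ExactlyOneUniversal H × ¬ IsK₂ G))
          × ¬ (TriangleCentered G × TriangleCentered H)

LowerBound⇒4≤ : ∀ {n m} {G : Graph n} {H : Graph m} {w} → LowerBound G H w → 4 ≤ w
LowerBound⇒4≤ (inj₁ (_ , _ , 4≤w))             = 4≤w
LowerBound⇒4≤ (inj₂ (inj₁ (_ , 6≤w)))          = ≤-trans decide≤ 6≤w
LowerBound⇒4≤ (inj₂ (inj₂ (inj₁ (_ , 7≤w))))   = ≤-trans decide≤ 7≤w
LowerBound⇒4≤ (inj₂ (inj₂ (inj₂ 8≤w)))         = ≤-trans decide≤ 8≤w

module Theorem {n m} (G : Graph n) (H : Graph m) (noG : NoIsolated G) (noH : NoIsolated H) where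
  open Transfer G H
  open UpperBounds G H

  vertices : ∀ f {k} → wt {n} {m} f ≡ suc k → Fin n × Fin m
  vertices f w≡suc = go n m f w≡suc
    where
    go : ∀ n' m' (f : V {n'} {m'} → Label) {k} → wt f ≡ suc k → Fin n' × Fin m'
    go zero     m'       f ()
    go (suc n') zero     f w≡suc with trans (≡-sym (trans (Σ²-const {suc n'} {0} 0) (*-zeroʳ (suc n')))) w≡suc
    ... | ()
    go (suc n') (suc m') f _ = zero , zero

  fromγ : ∀ {k} → IsγtR (G ⊗ H) (suc k) → LowerBound G H (suc k) × Bounded G H (suc k) × (Fin n × Fin m)
  fromγ γ with fromIsγtR γ
  ... | (f , tr , w≡k) , bounded =
    let (g , h) = vertices f w≡k in subst (LowerBound G H) w≡k (lowerBound G H noG noH g h f tr) , bounded , (g , h)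

  bounded≤ : ∀ {k k'} → Achievable G H k → Bounded G H k' → k' ≤ k
  bounded≤ (f , tr , w≤k) bounded = ≤-trans (bounded f tr) w≤k

  achievable4 : n ≡ 2 → m ≡ 2 → Achievable G H 4
  achievable4 n≡2 m≡2 = subst (Achievable G H) (cong₂ (λ a b → a * (b * 1)) n≡2 m≡2) (allOnes noG noH)

  achievable6 : Cond6 G H → Achievable G H 6
  achievable6 (inj₁ (twoG , twoH , _))             = twoUniversal⇒6 twoG twoH
  achievable6 (inj₂ (inj₁ (inj₁ (K₂-G , _ , U)))) = order2×universal⇒6 noG (K₂⇒order2 G K₂-G) noH U
  achievable6 (inj₂ (inj₁ (inj₂ (K₂-H , _ , U)))) =
    transpose-Achievable G H 6 (UpperBounds.order2×universal⇒6 H G noH (K₂⇒order2 H K₂-H) noG U)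
  achievable6 (inj₂ (inj₂ (tcG , tcH)))           = triangleCentered⇒6 tcG tcH

  vertices-of-Cond6 : Cond6 G H → Fin n × Fin m
  vertices-of-Cond6 (inj₁ (twoG , twoH , _))             = proj₁ twoG , proj₁ twoH
  vertices-of-Cond6 (inj₂ (inj₁ (inj₁ (K₂-G , _ , U)))) = Inverse.from (Iso.bij K₂-G) zero , proj₁ U
  vertices-of-Cond6 (inj₂ (inj₁ (inj₂ (K₂-H , _ , U)))) = proj₁ U , Inverse.from (Iso.bij K₂-H) zero
  vertices-of-Cond6 (inj₂ (inj₂ (tcG , tcH)))           = proj₁ tcG , proj₁ tcH

  Cond6⇒¬2-2 : Cond6 G H → n ≡ 2 → m ≡ 2 → ⊥
  Cond6⇒¬2-2 (inj₁ (_ , _ , inj₁ 3≤n))                 refl _    = <⇒≱ decide≤ 3≤n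
  Cond6⇒¬2-2 (inj₁ (_ , _ , inj₂ 3≤m))                 _    refl = <⇒≱ decide≤ 3≤m
  Cond6⇒¬2-2 (inj₂ (inj₁ (inj₁ (_ , 3≤m , _))))        _    refl = <⇒≱ decide≤ 3≤m
  Cond6⇒¬2-2 (inj₂ (inj₁ (inj₂ (_ , 3≤n , _))))        refl _    = <⇒≱ decide≤ 3≤n
  Cond6⇒¬2-2 (inj₂ (inj₂ ((_ , _ , _ , x~y , y~z , x~z , _) , _))) refl _ =
    <⇒≱ decide≤ (three-distinct⇒3≤ (adj⇒≢ G x~y) (adj⇒≢ G x~z) (adj⇒≢ G y~z))

  Cond7⇒¬Cond6 : Cond7 G H → ¬ Cond6 G H
  Cond7⇒¬Cond6 (_ , _ , inj₁ (oneG , _) , _) (inj₁ (twoG , _ , _)) = exactlyOne⇒¬atLeastTwo G oneG twoG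
  Cond7⇒¬Cond6 (_ , _ , inj₂ (oneH , _) , _) (inj₁ (_ , twoH , _)) = exactlyOne⇒¬atLeastTwo H oneH twoH
  Cond7⇒¬Cond6 (_ , _ , inj₁ (oneG , _) , _) (inj₂ (inj₁ (inj₁ (K₂-G , _)))) =
    exactlyOne⇒¬atLeastTwo G oneG (order2⇒twoUniversal G noG (K₂⇒order2 G K₂-G))
  Cond7⇒¬Cond6 (_ , _ , inj₂ (_ , ¬K₂-G) , _) (inj₂ (inj₁ (inj₁ (K₂-G , _)))) = ¬K₂-G K₂-G
  Cond7⇒¬Cond6 (_ , _ , inj₁ (_ , ¬K₂-H) , _) (inj₂ (inj₁ (inj₂ (K₂-H , _)))) = ¬K₂-H K₂-H
  Cond7⇒¬Cond6 (_ , _ , inj₂ (oneH , _) , _) (inj₂ (inj₁ (inj₂ (K₂-H , _)))) =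
    exactlyOne⇒¬atLeastTwo H oneH (order2⇒twoUniversal H noH (K₂⇒order2 H K₂-H))
  Cond7⇒¬Cond6 (_ , _ , _ , ¬tc) (inj₂ (inj₂ tc)) = ¬tc tc

  Cond7⇒¬2-2 : Cond7 G H → n ≡ 2 → m ≡ 2 → ⊥
  Cond7⇒¬2-2 (_ , _ , inj₁ (oneG , _) , _) n≡2 _ = exactlyOne⇒¬atLeastTwo G oneG (order2⇒twoUniversal G noG n≡2)
  Cond7⇒¬2-2 (_ , _ , inj₂ (oneH , _) , _) _ m≡2 = exactlyOne⇒¬atLeastTwo H oneH (order2⇒twoUniversal H noH m≡2)

  Cond7-intro : BothUniversal G H → ¬ Cond6 G H → ¬ (n ≡ 2 × m ≡ 2) → 2 ≤ n → 2 ≤ m → Cond7 G H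
  Cond7-intro (UG , UH) ¬c6 ¬2-2 2≤n 2≤m = UG , UH , exactlyOne , λ tc → ¬c6 (inj₂ (inj₂ tc))
    where
    exactlyOne : (ExactlyOneUniversal G × ¬ IsK₂ H) ⊎ (ExactlyOneUniversal H × ¬ IsK₂ G)
    exactlyOne with atLeastTwoUniversal? G | atLeastTwoUniversal? H
    ... | no ¬twoG | _ = inj₁ (uniqueUniversal G UG ¬twoG , ¬K₂-H)
      where
      ¬K₂-H : ¬ IsK₂ H
      ¬K₂-H K₂-H with 2≤⇒2or3≤ 2≤n
      ... | inj₁ n≡2 = ¬twoG (order2⇒twoUniversal G noG n≡2)
      ... | inj₂ 3≤n = ¬c6 (inj₂ (inj₁ (inj₂ (K₂-H , 3≤n , UG))))
    ... | yes _ | no ¬twoH = inj₂ (uniqueUniversal H UH ¬twoH , ¬K₂-G)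
      where
      ¬K₂-G : ¬ IsK₂ G
      ¬K₂-G K₂-G with 2≤⇒2or3≤ 2≤m
      ... | inj₁ m≡2 = ¬twoH (order2⇒twoUniversal H noH m≡2)
      ... | inj₂ 3≤m = ¬c6 (inj₂ (inj₁ (inj₁ (K₂-G , 3≤m , UH))))
    ... | yes twoG | yes twoH with 2≤⇒2or3≤ 2≤n | 2≤⇒2or3≤ 2≤m
    ...   | inj₁ n≡2 | inj₁ m≡2 = ⊥-elim (¬2-2 (n≡2 , m≡2))
    ...   | inj₂ 3≤n | _        = ⊥-elim (¬c6 (inj₁ (twoG , twoH , inj₁ 3≤n)))
    ...   | inj₁ _   | inj₂ 3≤m = ⊥-elim (¬c6 (inj₁ (twoG , twoH , inj₂ 3≤m)))

  -- (i) The weight is at least 4, and 5 is impossible: 4 is attained when both orders are 2.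
  part-i : ¬ IsγtR (G ⊗ H) 1 × ¬ IsγtR (G ⊗ H) 2 × ¬ IsγtR (G ⊗ H) 3 × ¬ IsγtR (G ⊗ H) 5
  part-i = (λ γ → <⇒≱ decide≤ (LowerBound⇒4≤ (proj₁ (fromγ γ)))) ,
           (λ γ → <⇒≱ decide≤ (LowerBound⇒4≤ (proj₁ (fromγ γ)))) ,
           (λ γ → <⇒≱ decide≤ (LowerBound⇒4≤ (proj₁ (fromγ γ)))) , not5
    where
    not5 : ¬ IsγtR (G ⊗ H) 5
    not5 γ with fromγ γ
    ... | inj₁ (n≡2 , m≡2 , _) , bounded , _ = <⇒≱ decide≤ (bounded≤ (achievable4 n≡2 m≡2) bounded)
    ... | inj₂ (inj₁ (_ , 6≤5)) , _          = <⇒≱ decide≤ 6≤5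
    ... | inj₂ (inj₂ (inj₁ (_ , 7≤5))) , _   = <⇒≱ decide≤ 7≤5
    ... | inj₂ (inj₂ (inj₂ 8≤5)) , _         = <⇒≱ decide≤ 8≤5

  part-ii : IsγtR (G ⊗ H) 4 ⇔ (IsK₂ G × IsK₂ H)
  part-ii = mk⇔ to from
    where
    to : IsγtR (G ⊗ H) 4 → IsK₂ G × IsK₂ H
    to γ with fromγ γ
    ... | inj₁ (n≡2 , m≡2 , _) , _ = order2⇒K₂ G noG n≡2 , order2⇒K₂ H noH m≡2
    ... | inj₂ (inj₁ (_ , 6≤4)) , _        = ⊥-elim (<⇒≱ decide≤ 6≤4)
    ... | inj₂ (inj₂ (inj₁ (_ , 7≤4))) , _ = ⊥-elim (<⇒≱ decide≤ 7≤4)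
    ... | inj₂ (inj₂ (inj₂ 8≤4)) , _       = ⊥-elim (<⇒≱ decide≤ 8≤4)
    from : IsK₂ G × IsK₂ H → IsγtR (G ⊗ H) 4
    from (K₂-G , K₂-H) = toIsγtR (achievable4 n≡2 m≡2) (λ f tr → LowerBound⇒4≤ (lowerBound G H noG noH g h f tr))
      where
      n≡2 : n ≡ 2
      n≡2 = K₂⇒order2 G K₂-G
      m≡2 : m ≡ 2
      m≡2 = K₂⇒order2 H K₂-H
      g : Fin n
      g = subst Fin (≡-sym n≡2) zero
      h : Fin m
      h = subst Fin (≡-sym m≡2) zero

  part-iii : IsγtR (G ⊗ H) 6 ⇔ Cond6 G H
  part-iii = mk⇔ to from
    where
    to : IsγtR (G ⊗ H) 6 → Cond6 G H
    to γ with fromγ γ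
    ... | inj₁ (n≡2 , m≡2 , _) , bounded , _ = ⊥-elim (<⇒≱ decide≤ (bounded≤ (achievable4 n≡2 m≡2) bounded))
    ... | inj₂ (inj₁ (c6 , _)) , _         = c6
    ... | inj₂ (inj₂ (inj₁ (_ , 7≤6))) , _ = ⊥-elim (<⇒≱ decide≤ 7≤6)
    ... | inj₂ (inj₂ (inj₂ 8≤6)) , _       = ⊥-elim (<⇒≱ decide≤ 8≤6)
    from : Cond6 G H → IsγtR (G ⊗ H) 6
    from c6 = toIsγtR (achievable6 c6) bounded
      where
      bounded : Bounded G H 6
      bounded f tr with lowerBound G H noG noH (proj₁ (vertices-of-Cond6 c6)) (proj₂ (vertices-of-Cond6 c6)) f tr
      ... | inj₁ (n≡2 , m≡2 , _)       = ⊥-elim (Cond6⇒¬2-2 c6 n≡2 m≡2)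
      ... | inj₂ (inj₁ (_ , 6≤w))        = 6≤w
      ... | inj₂ (inj₂ (inj₁ (_ , 7≤w))) = ≤-trans decide≤ 7≤w
      ... | inj₂ (inj₂ (inj₂ 8≤w))       = ≤-trans decide≤ 8≤w

  part-iv : IsγtR (G ⊗ H) 7 ⇔ Cond7 G H
  part-iv = mk⇔ to from
    where
    to : IsγtR (G ⊗ H) 7 → Cond7 G H
    to γ with fromγ γ
    ... | inj₁ (n≡2 , m≡2 , _) , bounded , _ = ⊥-elim (<⇒≱ decide≤ (bounded≤ (achievable4 n≡2 m≡2) bounded))
    ... | inj₂ (inj₁ (c6 , _)) , bounded , _ = ⊥-elim (<⇒≱ decide≤ (bounded≤ (achievable6 c6) bounded))
    ... | inj₂ (inj₂ (inj₂ 8≤7)) , _         = ⊥-elim (<⇒≱ decide≤ 8≤7)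
    ... | inj₂ (inj₂ (inj₁ (both , _))) , bounded , (g , h) =
      Cond7-intro both (λ c6 → <⇒≱ decide≤ (bounded≤ (achievable6 c6) bounded))
                       (λ (n≡2 , m≡2) → <⇒≱ decide≤ (bounded≤ (achievable4 n≡2 m≡2) bounded))
                       (noIsolated⇒2≤ G noG g) (noIsolated⇒2≤ H noH h)
    from : Cond7 G H → IsγtR (G ⊗ H) 7
    from c7@(UG , UH , _) = toIsγtR (universal⇒7 noG noH UG UH) bounded
      where
      bounded : Bounded G H 7
      bounded f tr with lowerBound G H noG noH (proj₁ UG) (proj₁ UH) f tr
      ... | inj₁ (n≡2 , m≡2 , _)       = ⊥-elim (Cond7⇒¬2-2 c7 n≡2 m≡2)
      ... | inj₂ (inj₁ (c6 , _))         = ⊥-elim (Cond7⇒¬Cond6 c7 c6)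
      ... | inj₂ (inj₂ (inj₁ (_ , 7≤w))) = 7≤w
      ... | inj₂ (inj₂ (inj₂ 8≤w))       = ≤-trans decide≤ 8≤w

  part-v : ¬ (HasUniversal G × HasUniversal H) → Isγt G 2 → Isγt H 2 →
           ¬ (TriangleCentered G × TriangleCentered H) → IsγtR (G ⊗ H) 8
  part-v ¬both γG γH ¬tc = toIsγtR (totalDomination2⇒8 γG γH) bounded
    where
    vertex : ∀ {k} (X : Graph k) → Isγt X 2 → Fin k
    vertex {zero}  X (([] , _ , ()) , _)
    vertex {suc k} X _ = zero
    bounded : Bounded G H 8
    bounded f tr with lowerBound G H noG noH (vertex G γG) (vertex H γH) f tr
    ... | inj₁ (n≡2 , m≡2 , _) = ⊥-elim (¬both (order2⇒hasUniversal G noG n≡2 , order2⇒hasUniversal H noH m≡2))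
    ... | inj₂ (inj₁ (inj₁ ((u , _ , _ , U , _) , (v , _ , _ , V' , _) , _) , _)) = ⊥-elim (¬both ((u , U) , (v , V')))
    ... | inj₂ (inj₁ (inj₂ (inj₁ (inj₁ (K₂-G , _ , UH))) , _)) =
      ⊥-elim (¬both (order2⇒hasUniversal G noG (K₂⇒order2 G K₂-G) , UH))
    ... | inj₂ (inj₁ (inj₂ (inj₁ (inj₂ (K₂-H , _ , UG))) , _)) =
      ⊥-elim (¬both (UG , order2⇒hasUniversal H noH (K₂⇒order2 H K₂-H)))
    ... | inj₂ (inj₁ (inj₂ (inj₂ tc) , _)) = ⊥-elim (¬tc tc)
    ... | inj₂ (inj₂ (inj₁ (both , _)))    = ⊥-elim (¬both both)
    ... | inj₂ (inj₂ (inj₂ 8≤w))           = 8≤w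

theorem10 : ∀ {n m} (G : Graph n) (H : Graph m) → NoIsolated G → NoIsolated H →
    -- (i)
    (¬ IsγtR (G ⊗ H) 1 × ¬ IsγtR (G ⊗ H) 2 × ¬ IsγtR (G ⊗ H) 3 × ¬ IsγtR (G ⊗ H) 5)
    -- (ii)
    × (IsγtR (G ⊗ H) 4 ⇔ (IsK₂ G × IsK₂ H))
    -- (iii)
    × (IsγtR (G ⊗ H) 6 ⇔
        ((AtLeastTwoUniversal G × AtLeastTwoUniversal H × (n ≥ 3 ⊎ m ≥ 3))
        ⊎ ((IsK₂ G × m ≥ 3 × HasUniversal H) ⊎ (IsK₂ H × n ≥ 3 × HasUniversal G))
        ⊎ (TriangleCentered G × TriangleCentered H)))
    -- (iv)
    × (IsγtR (G ⊗ H) 7 ⇔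
        (HasUniversal G × HasUniversal H
        × ((ExactlyOneUniversal G × ¬ IsK₂ H) ⊎ (ExactlyOneUniversal H × ¬ IsK₂ G))
        × ¬ (TriangleCentered G × TriangleCentered H)))
    -- (v)
    × (¬ (HasUniversal G × HasUniversal H) → Isγt G 2 → Isγt H 2 →
        ¬ (TriangleCentered G × TriangleCentered H) → IsγtR (G ⊗ H) 8)
theorem10 G H noG noH = part-i , part-ii , part-iii , part-iv , part-v
  where open Theorem G H noG noH
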